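{- Let $p$ be a prime, $n=p^2$, and let $\Gamma=\Gamma(D_{2n})$ be the intersection graph of $D_{2n}$. Then the hyper-Wiener index of $\Gamma$ is $WW(\Gamma)=\frac{1}{2}(6p^4+3p^3+6p^2+3p+2)$.
   Context: $D_{2n}=\langle r,s : r^n=s^2=1,\ srs=r^{ -1}\rangle$ is the dihedral group of order $2n$. The intersection graph $\Gamma(G)$ of a finite group $G$ has as vertices the proper non-trivial subgroups of $G$, two distinct vertices being adjacent iff their intersection is non-trivial. With sums over unordered pairs of distinct vertices and $d$ the graph distance, $W(\Gamma)=\sum_{\{u,v\}} d(u,v)$ and the hyper-Wiener index is $WW(\Gamma)=\frac12 W(\Gamma)+\frac12\sum_{\{u,v\}} d(u,v)^2$. -}

module Defs where

open import Data.Bool using (Bool; true; false; not; _∧_; _∨_; if_then_else_)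
open import Data.Nat using (ℕ; zero; suc; _+_; _∸_)
open import Data.Nat.DivMod using (_mod_)
open import Data.Fin using (Fin; toℕ) renaming (zero to fzero)
import Data.Fin as F
import Data.Bool as B
open import Data.Vec using (Vec; []; _∷_; lookup)
open import Data.Vec.Properties using (≡-dec)
open import Data.List using (List; []; _∷_; map; _++_; concatMap; filter; length; allFin; upTo)
open import Data.Bool.ListAction using (any; all)
open import Data.Product using (_×_; _,_; proj₁; proj₂)
open import Data.Maybe using (Maybe; just; nothing)
open import Data.Rational using (ℚ; ½) renaming (_/_ to _÷_; _+_ to _+ℚ_; _*_ to _*ℚ_)
open import Data.Integer using (+_)
open import Relation.Nullary.Decidable using (⌊_⌋)

-- The dihedral group D_{2n} = ⟨ r, s | r^n = s^2 = 1, srs = r^{-1} ⟩,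
-- realised concretely: the pair (k , b) stands for r^k s^b
-- (k ∈ Z/n, b ∈ {0,1}); every element has a unique such normal form.

addF : ∀ {n} → Fin n → Fin n → Fin n
addF {zero} ()
addF {suc m} a b = (toℕ a + toℕ b) mod (suc m)

negF : ∀ {n} → Fin n → Fin n
negF {zero} ()
negF {suc m} a = (suc m ∸ toℕ a) mod (suc m)

Elem : ℕ → Set
Elem n = Fin n × Bool

-- r^a s^b · r^c s^e  =  r^(a + (-1)^b c) s^(b+e)   (using s r^c = r^{-c} s)
mul : ∀ {n} → Elem n → Elem n → Elem n
mul (a , false) (c , e) = (addF a c , e)
mul (a , true)  (c , e) = (addF a (negF c) , not e)

inv : ∀ {n} → Elem n → Elem n
inv (a , false) = (negF a , false)
inv (a , true)  = (a , true)

isIdentity : ∀ {n} → Elem n → Bool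
isIdentity (a , b) = ⌊ toℕ a Data.Nat.≟ 0 ⌋ ∧ not b

eqElem : ∀ {n} → Elem n → Elem n → Bool
eqElem (a , b) (c , e) = ⌊ a F.≟ c ⌋ ∧ ⌊ b B.≟ e ⌋

elems : (n : ℕ) → List (Elem n)
elems n = concatMap (λ k → (k , false) ∷ (k , true) ∷ []) (allFin n)

-- Subsets of D_{2n}: (R , S) with  r^k ∈ H ⇔ R[k],  r^k s ∈ H ⇔ S[k].

Sub : ℕ → Set
Sub n = Vec Bool n × Vec Bool n

mem : ∀ {n} → Sub n → Elem n → Bool
mem H (k , false) = lookup (proj₁ H) k
mem H (k , true)  = lookup (proj₂ H) k

eqSub : ∀ {n} → Sub n → Sub n → Bool
eqSub (R , S) (R' , S') = ⌊ ≡-dec B._≟_ R R' ⌋ ∧ ⌊ ≡-dec B._≟_ S S' ⌋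

allVecs : (n : ℕ) → List (Vec Bool n)
allVecs zero = [] ∷ []
allVecs (suc n) = concatMap (λ v → (false ∷ v) ∷ (true ∷ v) ∷ []) (allVecs n)

allSubs : (n : ℕ) → List (Sub n)
allSubs n = concatMap (λ R → map (λ S → (R , S)) (allVecs n)) (allVecs n)

_⇒ᵇ_ : Bool → Bool → Bool
x ⇒ᵇ y = not x ∨ y

isSubgroup : ∀ {n} → Sub n → Bool
isSubgroup {n} H =
  (any isIdentity (elems n) ∧ all (λ x → isIdentity x ⇒ᵇ mem H x) (elems n))
  ∧ all (λ x → all (λ y → (mem H x ∧ mem H y) ⇒ᵇ mem H (mul x y)) (elems n)) (elems n)
  ∧ all (λ x → mem H x ⇒ᵇ mem H (inv x)) (elems n)

isProper : ∀ {n} → Sub n → Bool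
isProper {n} H = any (λ x → not (mem H x)) (elems n)

isNontrivial : ∀ {n} → Sub n → Bool
isNontrivial {n} H = any (λ x → not (isIdentity x) ∧ mem H x) (elems n)

vertices : (n : ℕ) → List (Sub n)
vertices n = filter (λ H → isSubgroup H ∧ isProper H ∧ isNontrivial H B.≟ true) (allSubs n)

adj : ∀ {n} → Sub n → Sub n → Bool
adj {n} H K = not (eqSub H K) ∧ any (λ x → not (isIdentity x) ∧ mem H x ∧ mem K x) (elems n)

reach : ∀ {n} → ℕ → Sub n → Sub n → Bool
reach zero H K = eqSub H K
reach {n} (suc k) H K = reach k H K ∨ any (λ L → adj H L ∧ reach k L K) (vertices n)

firstReach : ∀ {n} → List ℕ → Sub n → Sub n → Maybe ℕ
firstReach [] H K = nothing
firstReach (k ∷ ks) H K = if reach k H K then just k else firstReach ks H K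

-- graph distance; `nothing` means d = ∞ (no path).  A shortest path
-- never has more than |V| - 1 edges, so searching k < |V| suffices.
dist : ∀ {n} → Sub n → Sub n → Maybe ℕ
dist {n} H K = firstReach (upTo (length (vertices n))) H K

pairs : ∀ {A : Set} → List A → List (A × A)
pairs [] = []
pairs (x ∷ xs) = map (λ y → (x , y)) xs ++ pairs xs

sumMaybe : List (Maybe ℕ) → Maybe ℕ
sumMaybe [] = just 0
sumMaybe (nothing ∷ _) = nothing
sumMaybe (just a ∷ xs) with sumMaybe xs
... | nothing = nothing
... | just b = just (a Data.Nat.+ b)

mapMaybe : (ℕ → ℕ) → Maybe ℕ → Maybe ℕ
mapMaybe f nothing = nothing
mapMaybe f (just a) = just (f a)

wiener : ℕ → Maybe ℕ
wiener n = sumMaybe (map (λ uv → dist (proj₁ uv) (proj₂ uv)) (pairs (vertices n)))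

sumSqDist : ℕ → Maybe ℕ
sumSqDist n = sumMaybe (map (λ uv → mapMaybe (λ d → d Data.Nat.* d) (dist (proj₁ uv) (proj₂ uv))) (pairs (vertices n)))

ℕtoℚ : ℕ → ℚ
ℕtoℚ a = (+ a) ÷ 1

hyperWiener : ℕ → Maybe ℚ
hyperWiener n with wiener n | sumSqDist n
... | just w | just s = just (½ *ℚ ℕtoℚ w +ℚ ½ *ℚ ℕtoℚ s)
... | _ | _ = nothing

module Submission where

-- The proper non-trivial subgroups of D_{2p²} are ⟨r^p⟩, ⟨r⟩, the p subgroups ⟨r^p, r^j s⟩ of order 2p
-- and the p² subgroups ⟨r^i s⟩ of order 2. Indeed a subgroup containing r^k contains r^gcd(k, p²), so its
-- rotations are the multiples of 1, p or p², and once these are known a single reflection fixes the rest.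
-- The first p + 2 subgroups all contain r^p and form a clique, while ⟨r^i s⟩ meets only ⟨r^p, r^(i mod p) s⟩.
-- Hence ⟨r^i s⟩ is at distance 1 or 2 from each clique vertex, and two of them are at distance 2 or 3
-- according as i ≡ i′ (mod p) or not. Summing d + d² over ordered pairs gives 2 WW.

open import Defs
open import Data.Nat using (ℕ; _^_; _*_; _+_)
open import Data.Nat.Primality using (Prime)
open import Data.Maybe using (just)
open import Data.Rational using (½) renaming (_*_ to _*ℚ_)
open import Relation.Binary.PropositionalEquality using (_≡_)

open import Data.Bool using (Bool; true; false; not; _∧_; _∨_; if_then_else_)
import Data.Bool as B
open import Data.Bool.ListAction using (any; all)
open import Data.Bool.Properties using (∧-comm; if-float)
open import Data.Empty using (⊥; ⊥-elim)
open import Data.Fin using (Fin; toℕ; fromℕ<)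
import Data.Fin as F
open import Data.Fin.Properties using (toℕ-injective; toℕ<n; toℕ-fromℕ<; any?)
import Data.Integer as ℤ
import Data.Integer.Properties as ℤ
open import Data.List using (List; []; _∷_; map; _++_; concatMap; length; allFin; applyUpTo)
open import Data.List.Membership.Propositional using (_∈_; _∉_; find; lose)
open import Data.List.Membership.Propositional.Properties
  using (∈-∃++; ∈-allFin; ∈-filter⁺; ∈-filter⁻; ∈-map⁺; ∈-map⁻; ∈-++⁺ˡ; ∈-++⁺ʳ; ∈-++⁻; ∈-concatMap⁺; ∈-concatMap⁻)
open import Data.List.Properties using (length-map; length-tabulate; map-++; map-∘; map-cong; map-cong-local; map-tabulate)
open import Data.List.Relation.Binary.Permutation.Propositional using (_↭_; ↭-sym; ↭-trans; ↭-prep; ↭-refl)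
open import Data.List.Relation.Binary.Permutation.Propositional.Properties using (∈-resp-↭; shift; ↭-length; map⁺)
import Data.List.Relation.Unary.All as All
open import Data.List.Relation.Unary.AllPairs using ([]; _∷_)
open import Data.List.Relation.Unary.Any using (here; there)
open import Data.List.Relation.Unary.Unique.Propositional using (Unique)
import Data.List.Relation.Unary.Unique.Propositional.Properties as Unique
open import Data.Maybe using (Maybe; fromMaybe)
open import Data.Nat using (zero; suc; _∸_; _%_; _/_; _<_; _≤_; _≟_; NonZero; ≢-nonZero; z≤n; s≤s)
open import Data.Nat.Coprimality using (Coprime; coprime-divisor)
open import Data.Nat.DivMod
open import Data.Nat.Divisibility using (_∣_; _∣?_; 1∣_; divides; n∣m⇒m%n≡0; m%n≡0⇒n∣m; ∣-refl; ∣-trans; ∣⇒≤; *-cancelʳ-∣)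
open import Data.Nat.GCD using (module Bézout; module GCD)
open import Data.Nat.ListAction using (sum)
open import Data.Nat.ListAction.Properties using (sum-++; sum-↭)
open import Data.Nat.Primality using (prime⇒irreducible; prime⇒nonZero; ¬prime[0]; ¬prime[1])
open import Data.Nat.Properties
open import Data.Nat.Tactic.RingSolver using (solve-∀)
open import Data.Product using (_×_; _,_; proj₁; proj₂; ∃)
open import Data.Rational using () renaming (_+_ to _+ℚ_)
open import Data.Rational.Properties using (toℚᵘ-injective; toℚᵘ-fromℚᵘ; toℚᵘ-homo-+) renaming (*-distribˡ-+ to *-distribˡ-+ℚ)
open import Data.Rational.Unnormalised using (ℚᵘ; mkℚᵘ; _≃_; *≡*) renaming (_+_ to _+ᵘ_)
open import Data.Rational.Unnormalised.Properties using (≃-trans; ≃-sym; +-cong)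
open import Data.Sum using (_⊎_; inj₁; inj₂)
open import Data.Vec using (Vec; []; _∷_; lookup; tabulate)
open import Data.Vec.Properties using (≡-dec; lookup∘tabulate; tabulate∘lookup; tabulate-cong)
open import Function using (_∘_; case_of_)
open import Relation.Binary.PropositionalEquality using (_≢_; refl; sym; trans; cong; cong₂; subst; module ≡-Reasoning)
open import Relation.Nullary using (¬_; Dec; yes; no)
open import Relation.Nullary.Decidable using (⌊_⌋; _×-dec_; ¬?; decidable-stable)

∧-intro : ∀ {a b} → a ≡ true → b ≡ true → a ∧ b ≡ true
∧-intro refl refl = refl

∧-elimˡ : ∀ {a b} → a ∧ b ≡ true → a ≡ true
∧-elimˡ {true} _ = refl

∧-elimʳ : ∀ {a b} → a ∧ b ≡ true → b ≡ true
∧-elimʳ {true} e = e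

∧-falseˡ : ∀ {a b} → a ≡ false → a ∧ b ≡ false
∧-falseˡ refl = refl

∧-falseʳ : ∀ {a b} → b ≡ false → a ∧ b ≡ false
∧-falseʳ {true} e = e
∧-falseʳ {false} e = refl

∨-introˡ : ∀ {a b} → a ≡ true → a ∨ b ≡ true
∨-introˡ refl = refl

∨-introʳ : ∀ {a b} → b ≡ true → a ∨ b ≡ true
∨-introʳ {true} _ = refl
∨-introʳ {false} e = e

∨-elim : ∀ {a b} → a ∨ b ≡ true → a ≡ true ⊎ b ≡ true
∨-elim {true} _ = inj₁ refl
∨-elim {false} e = inj₂ e

∨-false : ∀ {a b} → a ≡ false → b ≡ false → a ∨ b ≡ false
∨-false refl refl = refl

⇒ᵇ-intro : ∀ {a b} → (a ≡ true → b ≡ true) → (a ⇒ᵇ b) ≡ true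
⇒ᵇ-intro {true} f = f refl
⇒ᵇ-intro {false} f = refl

⇒ᵇ-elim : ∀ {a b} → (a ⇒ᵇ b) ≡ true → a ≡ true → b ≡ true
⇒ᵇ-elim {true} e refl = e

not≡true⇒≡false : ∀ {a} → not a ≡ true → a ≡ false
not≡true⇒≡false {false} _ = refl

≡false⇒not≡true : ∀ {a} → a ≡ false → not a ≡ true
≡false⇒not≡true refl = refl

≢true⇒≡false : ∀ {a} → ¬ (a ≡ true) → a ≡ false
≢true⇒≡false {true} f = ⊥-elim (f refl)
≢true⇒≡false {false} f = refl

true≢false : ∀ {a} → a ≡ true → a ≡ false → ⊥
true≢false refl ()

bool-ext : ∀ {a b} → (a ≡ true → b ≡ true) → (b ≡ true → a ≡ true) → a ≡ b
bool-ext {true} {true} f g = refl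
bool-ext {true} {false} f g = sym (f refl)
bool-ext {false} {true} f g = g refl
bool-ext {false} {false} f g = refl

⌊⌋-true : ∀ {P : Set} (d : Dec P) → P → ⌊ d ⌋ ≡ true
⌊⌋-true (yes _) _ = refl
⌊⌋-true (no ¬p) p = ⊥-elim (¬p p)

⌊⌋-false : ∀ {P : Set} (d : Dec P) → ¬ P → ⌊ d ⌋ ≡ false
⌊⌋-false (yes p) ¬p = ⊥-elim (¬p p)
⌊⌋-false (no _) _ = refl

⌊⌋-sound : ∀ {P : Set} (d : Dec P) → ⌊ d ⌋ ≡ true → P
⌊⌋-sound (yes p) _ = p

⌊≟⌋-sym : ∀ {n} (i j : Fin n) → ⌊ i F.≟ j ⌋ ≡ ⌊ j F.≟ i ⌋
⌊≟⌋-sym i j = bool-ext (λ e → ⌊⌋-true (j F.≟ i) (sym (⌊⌋-sound (i F.≟ j) e)))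
                       (λ e → ⌊⌋-true (i F.≟ j) (sym (⌊⌋-sound (j F.≟ i) e)))

⌊≟⌋-refl : ∀ {n} (i : Fin n) → ⌊ i F.≟ i ⌋ ≡ true
⌊≟⌋-refl i = ⌊⌋-true (i F.≟ i) refl

if-true : ∀ {A : Set} {b} {x y : A} → b ≡ true → (if b then x else y) ≡ x
if-true refl = refl

if-false : ∀ {A : Set} {b} {x y : A} → b ≡ false → (if b then x else y) ≡ y
if-false refl = refl

all⁺ : ∀ {A : Set} (f : A → Bool) (xs : List A) → (∀ x → x ∈ xs → f x ≡ true) → all f xs ≡ true
all⁺ f [] h = refl
all⁺ f (y ∷ ys) h = ∧-intro (h y (here refl)) (all⁺ f ys (λ x m → h x (there m)))

all⁻ : ∀ {A : Set} (f : A → Bool) (xs : List A) → all f xs ≡ true → ∀ {x} → x ∈ xs → f x ≡ true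
all⁻ f (y ∷ ys) e (here refl) = ∧-elimˡ e
all⁻ f (y ∷ ys) e (there m) = all⁻ f ys (∧-elimʳ {f y} e) m

any⁺ : ∀ {A : Set} (f : A → Bool) (xs : List A) {x} → x ∈ xs → f x ≡ true → any f xs ≡ true
any⁺ f (y ∷ ys) (here refl) e = ∨-introˡ e
any⁺ f (y ∷ ys) (there m) e = ∨-introʳ {f y} (any⁺ f ys m e)

any⁻ : ∀ {A : Set} (f : A → Bool) (xs : List A) → any f xs ≡ true → ∃ λ x → x ∈ xs × f x ≡ true
any⁻ f (y ∷ ys) e with ∨-elim {f y} e
... | inj₁ fy = y , here refl , fy
... | inj₂ rest with any⁻ f ys rest
...   | x , m , fx = x , there m , fx

any-cong : ∀ {A : Set} {f g : A → Bool} (xs : List A) → (∀ x → f x ≡ g x) → any f xs ≡ any g xs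
any-cong [] _ = refl
any-cong (x ∷ xs) f≗g = cong₂ _∨_ (f≗g x) (any-cong xs f≗g)

any≡false : ∀ {A : Set} (f : A → Bool) (xs : List A) → (∀ x → x ∈ xs → f x ≡ false) → any f xs ≡ false
any≡false f [] h = refl
any≡false f (y ∷ ys) h = ∨-false (h y (here refl)) (any≡false f ys (λ x m → h x (there m)))

∈-concatMap⁺′ : ∀ {A B : Set} (f : A → List B) {xs x y} → x ∈ xs → y ∈ f x → y ∈ concatMap f xs
∈-concatMap⁺′ f x∈xs y∈fx = ∈-concatMap⁺ f (lose x∈xs y∈fx)

∈-concatMap⁻′ : ∀ {A B : Set} (f : A → List B) {xs y} → y ∈ concatMap f xs → ∃ λ x → x ∈ xs × y ∈ f x
∈-concatMap⁻′ f m = find (∈-concatMap⁻ f m)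

concatMap-unique : ∀ {A B : Set} (f : A → List B) {xs} → Unique xs → (∀ x → Unique (f x)) →
                   (∀ {x y z} → z ∈ f x → z ∈ f y → x ≡ y) → Unique (concatMap f xs)
concatMap-unique f {[]} _ _ _ = []
concatMap-unique f {x ∷ xs} (x∉xs ∷ u) uf disjoint =
  Unique.++⁺ (uf x) (concatMap-unique f u uf disjoint) λ (z∈fx , z∈rest) →
    let y , y∈xs , z∈fy = ∈-concatMap⁻′ f z∈rest in All.lookup x∉xs y∈xs (disjoint z∈fx z∈fy)

unique-drop : ∀ {A : Set} (ys zs : List A) x → Unique (ys ++ x ∷ zs) → Unique (ys ++ zs) × x ∉ ys ++ zs
unique-drop [] zs x (x∉zs ∷ u) = u , λ m → All.lookup x∉zs m refl
unique-drop (y ∷ ys) zs x (y∉ ∷ u) =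
  let u′ , x∉ = unique-drop ys zs x u in
  All.tabulate (λ m → All.lookup y∉ (skip m)) ∷ u′ , x∉′ x∉
  where
  skip : ∀ {z} → z ∈ ys ++ zs → z ∈ ys ++ x ∷ zs
  skip m with ∈-++⁻ ys m
  ... | inj₁ m₁ = ∈-++⁺ˡ m₁
  ... | inj₂ m₂ = ∈-++⁺ʳ ys (there m₂)
  x∉′ : x ∉ ys ++ zs → x ∉ y ∷ ys ++ zs
  x∉′ _ (here refl) = All.lookup y∉ (∈-++⁺ʳ ys (here refl)) refl
  x∉′ x∉ (there m) = x∉ m

unique-⇔⇒↭ : ∀ {A : Set} {xs ys : List A} → Unique xs → Unique ys →
             (∀ {z} → z ∈ xs → z ∈ ys) → (∀ {z} → z ∈ ys → z ∈ xs) → xs ↭ ys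
unique-⇔⇒↭ {xs = []} {[]} _ _ _ _ = ↭-refl
unique-⇔⇒↭ {xs = []} {y ∷ ys} _ _ _ to with to (here refl)
... | ()
unique-⇔⇒↭ {xs = x ∷ xs} (x∉xs ∷ u) v from to with ∈-∃++ (from (here refl))
... | ys , zs , refl =
  ↭-trans (↭-prep x (unique-⇔⇒↭ u (proj₁ dropped) from′ to′)) (↭-sym (shift x ys zs))
  where
  dropped = unique-drop ys zs x v
  from′ : ∀ {z} → z ∈ xs → z ∈ ys ++ zs
  from′ m with ∈-++⁻ ys (from (there m))
  ... | inj₁ m₁ = ∈-++⁺ˡ m₁
  ... | inj₂ (here refl) = ⊥-elim (All.lookup x∉xs m refl)
  ... | inj₂ (there m₂) = ∈-++⁺ʳ ys m₂
  to′ : ∀ {z} → z ∈ ys ++ zs → z ∈ xs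
  to′ m with to (∈-resp-↭ (↭-sym (shift x ys zs)) (there m))
  ... | here refl = ⊥-elim (proj₂ dropped m)
  ... | there m′ = m′

elems-complete : ∀ {n} (x : Elem n) → x ∈ elems n
elems-complete {n} (k , false) = ∈-concatMap⁺′ _ (∈-allFin k) (here refl)
elems-complete {n} (k , true) = ∈-concatMap⁺′ _ (∈-allFin k) (there (here refl))

allVecs-complete : ∀ {n} (v : Vec Bool n) → v ∈ allVecs n
allVecs-complete [] = here refl
allVecs-complete (false ∷ v) = ∈-concatMap⁺′ _ (allVecs-complete v) (here refl)
allVecs-complete (true ∷ v) = ∈-concatMap⁺′ _ (allVecs-complete v) (there (here refl))

allVecs-unique : ∀ n → Unique (allVecs n)
allVecs-unique zero = All.[] ∷ []
allVecs-unique (suc n) = concatMap-unique _ (allVecs-unique n) (λ _ → ((λ ()) All.∷ All.[]) ∷ All.[] ∷ []) tails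
  where
  tails : ∀ {v w u} → u ∈ (false ∷ v) ∷ (true ∷ v) ∷ [] → u ∈ (false ∷ w) ∷ (true ∷ w) ∷ [] → v ≡ w
  tails (here refl) (here refl) = refl
  tails (here refl) (there (here ()))
  tails (there (here refl)) (here ())
  tails (there (here refl)) (there (here refl)) = refl

allSubs-complete : ∀ {n} (H : Sub n) → H ∈ allSubs n
allSubs-complete (R , S) = ∈-concatMap⁺′ _ (allVecs-complete R) (∈-map⁺ _ (allVecs-complete S))

allSubs-unique : ∀ n → Unique (allSubs n)
allSubs-unique n = concatMap-unique _ (allVecs-unique n) (λ _ → Unique.map⁺ (cong proj₂) (allVecs-unique n)) firsts
  where
  firsts : ∀ {R R′ H} → H ∈ map (R ,_) (allVecs n) → H ∈ map (R′ ,_) (allVecs n) → R ≡ R′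
  firsts m m′ with ∈-map⁻ _ m | ∈-map⁻ _ m′
  ... | _ , _ , refl | _ , _ , refl = refl

-- The intersection graph

isVertex : ∀ {n} → Sub n → Bool
isVertex H = isSubgroup H ∧ isProper H ∧ isNontrivial H

eqSub-refl : ∀ {n} (H : Sub n) → eqSub H H ≡ true
eqSub-refl (R , S) = ∧-intro (⌊⌋-true (≡-dec B._≟_ R R) refl) (⌊⌋-true (≡-dec B._≟_ S S) refl)

eqSub-sound : ∀ {n} {H K : Sub n} → eqSub H K ≡ true → H ≡ K
eqSub-sound {H = R , S} {R′ , S′} e = cong₂ _,_
  (⌊⌋-sound (≡-dec B._≟_ R R′) (∧-elimˡ e)) (⌊⌋-sound (≡-dec B._≟_ S S′) (∧-elimʳ {⌊ ≡-dec B._≟_ R R′ ⌋} e))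

eqSub-false : ∀ {n} {H K : Sub n} → H ≢ K → eqSub H K ≡ false
eqSub-false H≢K = ≢true⇒≡false (H≢K ∘ eqSub-sound)

eqSub-sym : ∀ {n} (H K : Sub n) → eqSub H K ≡ eqSub K H
eqSub-sym H K = bool-ext (λ e → subst (λ L → eqSub L H ≡ true) (eqSub-sound {H = H} {K} e) (eqSub-refl H))
                         (λ e → subst (λ L → eqSub L K ≡ true) (eqSub-sound {H = K} {H} e) (eqSub-refl K))

adj-sym : ∀ {n} (H K : Sub n) → adj H K ≡ adj K H
adj-sym {n} H K = cong₂ _∧_ (cong not (eqSub-sym H K))
  (any-cong (elems n) λ x → cong (not (isIdentity x) ∧_) (∧-comm (mem H x) (mem K x)))

adj-self : ∀ {n} (H : Sub n) → adj H H ≡ false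
adj-self H = ∧-falseˡ (cong not (eqSub-refl H))

adj-intro : ∀ {n} {H K : Sub n} x → H ≢ K → isIdentity x ≡ false → mem H x ≡ true → mem K x ≡ true → adj H K ≡ true
adj-intro {n} {H} {K} x H≢K nid xH xK = ∧-intro (≡false⇒not≡true (eqSub-false H≢K))
  (any⁺ (λ x → not (isIdentity x) ∧ mem H x ∧ mem K x) (elems n) (elems-complete x)
    (∧-intro (≡false⇒not≡true nid) (∧-intro xH xK)))

adj-false : ∀ {n} {H K : Sub n} → (∀ x → isIdentity x ≡ false → mem H x ≡ true → mem K x ≡ true → ⊥) → adj H K ≡ false
adj-false {n} {H} {K} disjoint = ∧-falseʳ {not (eqSub H K)}
  (any≡false (λ x → not (isIdentity x) ∧ mem H x ∧ mem K x) (elems n) λ x _ → ≢true⇒≡false λ e →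
    let e′ = ∧-elimʳ {not (isIdentity x)} e in
    disjoint x (not≡true⇒≡false (∧-elimˡ e)) (∧-elimˡ e′) (∧-elimʳ {mem H x} e′))

reach-0 : ∀ {n} {H K : Sub n} → H ≢ K → reach 0 H K ≡ false
reach-0 = eqSub-false

reach-step : ∀ {n} k {H L K : Sub n} → L ∈ vertices n → adj H L ≡ true → reach k L K ≡ true → reach (suc k) H K ≡ true
reach-step {n} k {H} {L} {K} L∈V a r = ∨-introʳ {reach k H K} (any⁺ (λ L → adj H L ∧ reach k L K) (vertices n) L∈V (∧-intro a r))

reach-step-false : ∀ {n} k {H K : Sub n} → reach k H K ≡ false →
                   (∀ L → L ∈ vertices n → adj H L ≡ true → reach k L K ≡ false) → reach (suc k) H K ≡ false
reach-step-false {n} k {H} {K} r h = ∨-false r (any≡false (λ L → adj H L ∧ reach k L K) (vertices n) λ L L∈V →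
  ≢true⇒≡false λ e → true≢false (∧-elimʳ {adj H L} e) (h L L∈V (∧-elimˡ e)))

reach-1 : ∀ {n} {H K : Sub n} → K ∈ vertices n → adj H K ≡ true → reach 1 H K ≡ true
reach-1 {K = K} K∈V a = reach-step 0 K∈V a (eqSub-refl K)

reach-1-false : ∀ {n} {H K : Sub n} → H ≢ K → adj H K ≡ false → reach 1 H K ≡ false
reach-1-false {H = H} {K} H≢K na = reach-step-false 0 (reach-0 {H = H} {K} H≢K) λ L _ a → reach-0 {H = L} {K} λ { refl → true≢false a na }

firstReach-applyUpTo : ∀ {n} {H K : Sub n} f L i → i < L → reach (f i) H K ≡ true →
                       (∀ j → j < i → reach (f j) H K ≡ false) → firstReach (applyUpTo f L) H K ≡ just (f i)
firstReach-applyUpTo f (suc L) zero _ r _ = if-true r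
firstReach-applyUpTo f (suc L) (suc i) (s≤s i<L) r earlier =
  trans (if-false (earlier 0 (s≤s z≤n))) (firstReach-applyUpTo (f ∘ suc) L i i<L r (λ j j<i → earlier (suc j) (s≤s j<i)))

dist-≡ : ∀ {n} {H K : Sub n} d → d < length (vertices n) → reach d H K ≡ true →
         (∀ k → k < d → reach k H K ≡ false) → dist H K ≡ just d
dist-≡ d = firstReach-applyUpTo (λ k → k) _ d

dist-0 : ∀ {n} (H : Sub n) → 0 < length (vertices n) → dist H H ≡ just 0
dist-0 H 0<V = dist-≡ {H = H} {H} 0 0<V (eqSub-refl H) λ _ ()

dist-1 : ∀ {n} {H K : Sub n} → 1 < length (vertices n) → K ∈ vertices n → H ≢ K → adj H K ≡ true → dist H K ≡ just 1
dist-1 {H = H} {K} 1<V K∈V H≢K a = dist-≡ {H = H} {K} 1 1<V (reach-1 {H = H} K∈V a) λ where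
  zero _ → reach-0 {H = H} {K} H≢K
  (suc _) (s≤s ())

dist-2 : ∀ {n} {H L K : Sub n} → 2 < length (vertices n) → L ∈ vertices n → K ∈ vertices n →
         H ≢ K → adj H K ≡ false → adj H L ≡ true → adj L K ≡ true → dist H K ≡ just 2
dist-2 {H = H} {L} {K} 2<V L∈V K∈V H≢K na aHL aLK =
  dist-≡ {H = H} {K} 2 2<V (reach-step 1 {H} {L} {K} L∈V aHL (reach-1 {H = L} K∈V aLK)) λ where
    zero _ → reach-0 {H = H} {K} H≢K
    (suc zero) _ → reach-1-false {H = H} {K} H≢K na
    (suc (suc _)) (s≤s (s≤s ()))

dist-3 : ∀ {n} {H L L′ K : Sub n} → 3 < length (vertices n) → L ∈ vertices n → L′ ∈ vertices n → K ∈ vertices n →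
         H ≢ K → adj H K ≡ false → (∀ M → M ∈ vertices n → adj H M ≡ true → M ≢ K × adj M K ≡ false) →
         adj H L ≡ true → adj L L′ ≡ true → adj L′ K ≡ true → dist H K ≡ just 3
dist-3 {H = H} {L} {L′} {K} 3<V L∈V L′∈V K∈V H≢K na no-common aHL aLL′ aL′K =
  dist-≡ {H = H} {K} 3 3<V
    (reach-step 2 {H} {L} {K} L∈V aHL (reach-step 1 {L} {L′} {K} L′∈V aLL′ (reach-1 {H = L′} K∈V aL′K))) λ where
    zero _ → reach-0 {H = H} {K} H≢K
    (suc zero) _ → reach-1-false {H = H} {K} H≢K na
    (suc (suc zero)) _ → reach-step-false 1 {H} {K} (reach-1-false {H = H} {K} H≢K na) λ M M∈V aHM →
      let M≢K , nMK = no-common M M∈V aHM in reach-1-false {H = M} {K} M≢K nMK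
    (suc (suc (suc _))) (s≤s (s≤s (s≤s ())))

sumFin : ∀ n → (Fin n → ℕ) → ℕ
sumFin n f = sum (map f (allFin n))

ΣΣ : ∀ {A : Set} → List A → (A → A → ℕ) → ℕ
ΣΣ xs f = sum (map (λ x → sum (map (f x) xs)) xs)

pairSum : ∀ {A : Set} → List A → (A → A → ℕ) → ℕ
pairSum xs f = sum (map (λ (x , y) → f x y) (pairs xs))

sum-map-++ : ∀ {A : Set} (g : A → ℕ) xs ys → sum (map g (xs ++ ys)) ≡ sum (map g xs) + sum (map g ys)
sum-map-++ g xs ys = trans (cong sum (map-++ g xs ys)) (sum-++ (map g xs) (map g ys))

sum-map-∘ : ∀ {A B : Set} (g : B → ℕ) (f : A → B) xs → sum (map g (map f xs)) ≡ sum (map (g ∘ f) xs)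
sum-map-∘ g f xs = cong sum (sym (map-∘ xs))

sum-cong : ∀ {A : Set} {g h : A → ℕ} xs → (∀ x → g x ≡ h x) → sum (map g xs) ≡ sum (map h xs)
sum-cong xs g≗h = cong sum (map-cong g≗h xs)

sum-+ : ∀ {A : Set} (g h : A → ℕ) xs → sum (map (λ x → g x + h x) xs) ≡ sum (map g xs) + sum (map h xs)
sum-+ g h [] = refl
sum-+ g h (x ∷ xs) = trans (cong (g x + h x +_) (sum-+ g h xs)) (interchange (g x) (h x) (sum (map g xs)) (sum (map h xs)))
  where
  interchange : ∀ a b c d → a + b + (c + d) ≡ a + c + (b + d)
  interchange = solve-∀

sum-concatMap : ∀ {A B : Set} (g : B → ℕ) (f : A → List B) xs →
                sum (map g (concatMap f xs)) ≡ sum (map (λ x → sum (map g (f x))) xs)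
sum-concatMap g f [] = refl
sum-concatMap g f (x ∷ xs) = trans (sum-map-++ g (f x) (concatMap f xs)) (cong (sum (map g (f x)) +_) (sum-concatMap g f xs))

sumFin-const : ∀ n c → sumFin n (λ _ → c) ≡ n * c
sumFin-const n c = trans (const-sum (allFin n)) (cong (_* c) (length-tabulate {n = n} (λ i → i)))
  where
  const-sum : ∀ {A : Set} (xs : List A) → sum (map (λ _ → c) xs) ≡ length xs * c
  const-sum [] = refl
  const-sum (_ ∷ xs) = cong (c +_) (const-sum xs)

sumFin-suc : ∀ m (g : Fin (suc m) → ℕ) → sumFin (suc m) g ≡ g F.zero + sumFin m (g ∘ F.suc)
sumFin-suc m g = cong (g F.zero +_) (cong sum (trans (map-tabulate F.suc g) (sym (map-tabulate (λ i → i) (g ∘ F.suc)))))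

sumFin-indicator : ∀ m (i : Fin (suc m)) a b → sumFin (suc m) (λ j → if ⌊ i F.≟ j ⌋ then a else b) ≡ a + m * b
sumFin-indicator m F.zero a b = trans (sumFin-suc m (λ j → if ⌊ F.zero F.≟ j ⌋ then a else b)) (cong (a +_) (sumFin-const m b))
sumFin-indicator (suc m) (F.suc i) a b = begin
  sumFin (suc (suc m)) (λ j → if ⌊ F.suc i F.≟ j ⌋ then a else b)
    ≡⟨ sumFin-suc (suc m) (λ j → if ⌊ F.suc i F.≟ j ⌋ then a else b) ⟩
  b + sumFin (suc m) (λ j → if ⌊ F.suc i F.≟ F.suc j ⌋ then a else b)
    ≡⟨ cong (b +_) (sum-cong (allFin (suc m)) λ j → cong (if_then a else b) (⌊suc≟suc⌋ i j)) ⟩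
  b + sumFin (suc m) (λ j → if ⌊ i F.≟ j ⌋ then a else b)
    ≡⟨ cong (b +_) (sumFin-indicator m i a b) ⟩
  b + (a + m * b)
    ≡⟨ swap-front b a (m * b) ⟩
  a + suc m * b
    ∎
  where
  open ≡-Reasoning
  ⌊suc≟suc⌋ : ∀ {n} (i j : Fin n) → ⌊ F.suc i F.≟ F.suc j ⌋ ≡ ⌊ i F.≟ j ⌋
  ⌊suc≟suc⌋ i j with i F.≟ j
  ... | yes refl = refl
  ... | no _ = refl
  swap-front : ∀ x y z → x + (y + z) ≡ y + (x + z)
  swap-front = solve-∀

sumMaybe-just : ∀ {A : Set} (g : A → Maybe ℕ) (h : A → ℕ) xs → (∀ x → x ∈ xs → g x ≡ just (h x)) →
                sumMaybe (map g xs) ≡ just (sum (map h xs))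
sumMaybe-just g h [] _ = refl
sumMaybe-just g h (x ∷ xs) e rewrite e x (here refl) | sumMaybe-just g h xs (λ y m → e y (there m)) = refl

∈-pairs⁻ : ∀ {A : Set} (xs : List A) {uv} → uv ∈ pairs xs → proj₁ uv ∈ xs × proj₂ uv ∈ xs
∈-pairs⁻ (x ∷ xs) m with ∈-++⁻ (map (x ,_) xs) m
... | inj₁ m₁ = let _ , y∈xs , e = ∈-map⁻ (x ,_) m₁ in
  subst (λ uv → proj₁ uv ∈ x ∷ xs × proj₂ uv ∈ x ∷ xs) (sym e) (here refl , there y∈xs)
... | inj₂ m₂ = let u∈ , v∈ = ∈-pairs⁻ xs m₂ in there u∈ , there v∈

pairSum-double : ∀ {A : Set} (f : A → A → ℕ) xs → (∀ x y → x ∈ xs → y ∈ xs → f x y ≡ f y x) →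
                 (∀ x → x ∈ xs → f x x ≡ 0) → 2 * pairSum xs f ≡ ΣΣ xs f
pairSum-double f [] _ _ = refl
pairSum-double f (x ∷ xs) symmetric diagonal = begin
  2 * pairSum (x ∷ xs) f  ≡⟨ cong (2 *_) (trans (sum-map-++ _ (map (x ,_) xs) (pairs xs)) (cong (_+ P) (sum-map-∘ _ (x ,_) xs))) ⟩
  2 * (Σx + P)  ≡⟨ double Σx P ⟩
  Σx + (Σx + 2 * P)  ≡⟨ cong₂ (λ u v → u + (v + 2 * P)) (cong (_+ Σx) (sym (diagonal x (here refl)))) column ⟩
  (f x x + Σx) + (sum (map (λ u → f u x) xs) + 2 * P)
    ≡⟨ cong (λ v → (f x x + Σx) + (sum (map (λ u → f u x) xs) + v))
            (pairSum-double f xs (λ a b a∈ b∈ → symmetric a b (there a∈) (there b∈)) (λ a a∈ → diagonal a (there a∈))) ⟩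
  (f x x + Σx) + (sum (map (λ u → f u x) xs) + ΣΣ xs f)
    ≡⟨ cong ((f x x + Σx) +_) (sum-+ (λ u → f u x) (λ u → sum (map (f u) xs)) xs) ⟨
  ΣΣ (x ∷ xs) f  ∎
  where
  open ≡-Reasoning
  Σx = sum (map (f x) xs)
  P = pairSum xs f
  double : ∀ a b → 2 * (a + b) ≡ a + (a + 2 * b)
  double = solve-∀
  column : Σx ≡ sum (map (λ u → f u x) xs)
  column = cong sum (map-cong-local (All.tabulate λ {y} y∈xs → symmetric x y (here refl) (there y∈xs)))

ΣΣ-↭ : ∀ {A : Set} (f : A → A → ℕ) {xs ys} → xs ↭ ys → ΣΣ xs f ≡ ΣΣ ys f
ΣΣ-↭ f {xs} {ys} xs↭ys =
  trans (sum-cong xs λ x → sum-↭ (map⁺ (f x) xs↭ys)) (sum-↭ (map⁺ (λ x → sum (map (f x) ys)) xs↭ys))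

ΣΣ-map : ∀ {A B : Set} (f : B → B → ℕ) (g : A → B) xs → ΣΣ (map g xs) f ≡ ΣΣ xs (λ a b → f (g a) (g b))
ΣΣ-map f g xs = trans (sum-map-∘ (λ x → sum (map (f x) (map g xs))) g xs) (sum-cong xs λ x → sum-map-∘ (f (g x)) g xs)

ΣΣ-+ : ∀ {A : Set} (f g : A → A → ℕ) xs → ΣΣ xs (λ a b → f a b + g a b) ≡ ΣΣ xs f + ΣΣ xs g
ΣΣ-+ f g xs = trans (sum-cong xs λ x → sum-+ (f x) (g x) xs) (sum-+ (λ x → sum (map (f x) xs)) (λ x → sum (map (g x) xs)) xs)

ℕtoℚ-+ : ∀ a b → ℕtoℚ (a + b) ≡ ℕtoℚ a +ℚ ℕtoℚ b
ℕtoℚ-+ a b = toℚᵘ-injective (≃-trans (toℚᵘ-fromℚᵘ (integer (a + b)))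
  (≃-sym (≃-trans (toℚᵘ-homo-+ (ℕtoℚ a) (ℕtoℚ b))
    (≃-trans (+-cong (toℚᵘ-fromℚᵘ (integer a)) (toℚᵘ-fromℚᵘ (integer b))) sum-integers))))
  where
  integer : ℕ → ℚᵘ
  integer a = mkℚᵘ (ℤ.+ a) 0
  sum-integers : (integer a +ᵘ integer b) ≃ integer (a + b)
  sum-integers = *≡* (trans (ℤ.*-identityʳ _) (trans (cong₂ ℤ._+_ (ℤ.*-identityʳ (ℤ.+ a)) (ℤ.*-identityʳ (ℤ.+ b)))
                       (trans (sym (ℤ.pos-+ a b)) (sym (ℤ.*-identityʳ (ℤ.+ (a + b)))))))

hyperWiener-just : ∀ n {w s} → wiener n ≡ just w → sumSqDist n ≡ just s → hyperWiener n ≡ just (½ *ℚ ℕtoℚ (w + s))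
hyperWiener-just n {w} {s} ew es with wiener n | sumSqDist n
hyperWiener-just n {w} {s} refl refl | just .w | just .s =
  cong just (trans (sym (*-distribˡ-+ℚ ½ (ℕtoℚ w) (ℕtoℚ s))) (cong (½ *ℚ_) (sym (ℕtoℚ-+ w s))))

module Modular (d : ℕ) .{{_ : NonZero d}} where
  open ≡-Reasoning

  0%d≡0 : 0 % d ≡ 0
  0%d≡0 = m*n%n≡0 0 d

  %-cong-+ : ∀ {x x′ y y′} → x % d ≡ x′ % d → y % d ≡ y′ % d → (x + y) % d ≡ (x′ + y′) % d
  %-cong-+ {x} {x′} {y} {y′} ex ey = begin
    (x + y) % d            ≡⟨ %-distribˡ-+ x y d ⟩
    (x % d + y % d) % d    ≡⟨ cong₂ (λ a b → (a + b) % d) ex ey ⟩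
    (x′ % d + y′ % d) % d  ≡⟨ %-distribˡ-+ x′ y′ d ⟨
    (x′ + y′) % d          ∎

  +-[n∸c]+c : ∀ {n} → d ∣ n → ∀ a {c} → c ≤ n → (a + (n ∸ c) + c) % d ≡ a % d
  +-[n∸c]+c {n} d∣n a {c} c≤n = begin
    (a + (n ∸ c) + c) % d  ≡⟨ cong (_% d) (trans (+-assoc a (n ∸ c) c) (cong (a +_) (m∸n+n≡m c≤n))) ⟩
    (a + n) % d            ≡⟨ %-cong-+ {a} refl (trans (n∣m⇒m%n≡0 n d d∣n) (sym 0%d≡0)) ⟩
    (a + 0) % d            ≡⟨ cong (_% d) (+-identityʳ a) ⟩
    a % d                  ∎

  -- Adding d ∸ z % d undoes adding z.
  %-cancelʳ-+ : ∀ {x y} z → (x + z) % d ≡ (y + z) % d → x % d ≡ y % d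
  %-cancelʳ-+ {x} {y} z e = trans (undo x) (trans (%-cong-+ {x + z} {y + z} e refl) (sym (undo y)))
    where
    w = d ∸ z % d
    undo : ∀ u → u % d ≡ (u + z + w) % d
    undo u = begin
      u % d                  ≡⟨ +-[n∸c]+c ∣-refl u (m%n≤n z d) ⟨
      (u + w + z % d) % d    ≡⟨ cong (_% d) (trans (+-assoc u w (z % d)) (trans (cong (u +_) (+-comm w (z % d))) (sym (+-assoc u (z % d) w)))) ⟩
      (u + z % d + w) % d    ≡⟨ %-cong-+ {u + z % d} (%-cong-+ {u} refl (m%n%n≡m%n z d)) refl ⟩
      (u + z + w) % d        ∎

  +[n∸c]≡⇒≡+c : ∀ {n} → d ∣ n → ∀ a b {c} → c ≤ n → (a + (n ∸ c)) % d ≡ b % d → a % d ≡ (b + c) % d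
  +[n∸c]≡⇒≡+c d∣n a b {c} c≤n e = trans (sym (+-[n∸c]+c d∣n a c≤n)) (%-cong-+ e refl)

  ≡+c⇒+[n∸c]≡ : ∀ {n} → d ∣ n → ∀ a b {c} → c ≤ n → a % d ≡ (b + c) % d → (a + (n ∸ c)) % d ≡ b % d
  ≡+c⇒+[n∸c]≡ d∣n a b {c} c≤n e = %-cancelʳ-+ c (trans (+-[n∸c]+c d∣n a c≤n) e)

module _ {m : ℕ} where
  private n = suc m

  toℕ-mod : ∀ x → toℕ (x mod n) ≡ x % n
  toℕ-mod x = toℕ-fromℕ< _

  toℕ-addF : ∀ (a b : Fin n) → toℕ (addF a b) ≡ (toℕ a + toℕ b) % n
  toℕ-addF a b = toℕ-fromℕ< _

  toℕ-negF : ∀ (a : Fin n) → toℕ (negF a) ≡ (n ∸ toℕ a) % n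
  toℕ-negF a = toℕ-fromℕ< _

  toℕ-mod-id : ∀ (k : Fin n) → toℕ k mod n ≡ k
  toℕ-mod-id k = toℕ-injective (trans (toℕ-mod (toℕ k)) (m<n⇒m%n≡m (toℕ<n k)))

  mod-cong : ∀ {x y} → x % n ≡ y % n → x mod n ≡ y mod n
  mod-cong {x} {y} e = toℕ-injective (trans (toℕ-mod x) (trans e (sym (toℕ-mod y))))

  addF-mod : ∀ a b → addF (a mod n) (b mod n) ≡ (a + b) mod n
  addF-mod a b = mod-cong {toℕ (a mod n) + toℕ (b mod n)} {a + b}
    (trans (cong₂ (λ u v → (u + v) % n) (toℕ-mod a) (toℕ-mod b)) (sym (%-distribˡ-+ a b n)))

  negF-mod : ∀ a → negF (a mod n) ≡ (n ∸ a % n) mod n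
  negF-mod a = mod-cong {n ∸ toℕ (a mod n)} {n ∸ a % n} (cong (λ u → (n ∸ u) % n) (toℕ-mod a))

-- Subsets of D_{2n} described by the exponents of their rotations and reflections

memᴺ : ∀ {n} → (ℕ → Bool) → (ℕ → Bool) → Elem n → Bool
memᴺ ρ σ (k , false) = ρ (toℕ k)
memᴺ ρ σ (k , true) = σ (toℕ k)

subset : ∀ {n} → (ℕ → Bool) → (ℕ → Bool) → Sub n
subset ρ σ = tabulate (ρ ∘ toℕ) , tabulate (σ ∘ toℕ)

mem-subset : ∀ {n} ρ σ (x : Elem n) → mem (subset ρ σ) x ≡ memᴺ ρ σ x
mem-subset ρ σ (k , false) = lookup∘tabulate (ρ ∘ toℕ) k
mem-subset ρ σ (k , true) = lookup∘tabulate (σ ∘ toℕ) k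

subset-≡ : ∀ {n} {R S : Vec Bool n} {ρ σ} → (∀ k → lookup R k ≡ ρ (toℕ k)) → (∀ k → lookup S k ≡ σ (toℕ k)) →
           (R , S) ≡ subset ρ σ
subset-≡ {R = R} {S} R≗ S≗ =
  cong₂ _,_ (trans (sym (tabulate∘lookup R)) (tabulate-cong R≗)) (trans (sym (tabulate∘lookup S)) (tabulate-cong S≗))

record Closed (n : ℕ) .{{_ : NonZero n}} (ρ σ : ℕ → Bool) : Set where
  field
    one     : ρ 0 ≡ true
    rot·rot : ∀ a c → ρ a ≡ true → ρ c ≡ true → ρ ((a + c) % n) ≡ true
    rot·ref : ∀ a c → ρ a ≡ true → σ c ≡ true → σ ((a + c) % n) ≡ true
    ref·rot : ∀ a c → c < n → σ a ≡ true → ρ c ≡ true → σ ((a + (n ∸ c) % n) % n) ≡ true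
    ref·ref : ∀ a c → c < n → σ a ≡ true → σ c ≡ true → ρ ((a + (n ∸ c) % n) % n) ≡ true
    rot⁻¹   : ∀ a → a < n → ρ a ≡ true → ρ ((n ∸ a) % n) ≡ true

closed⇒isSubgroup : ∀ {m ρ σ} → Closed (suc m) ρ σ → isSubgroup {suc m} (subset ρ σ) ≡ true
closed⇒isSubgroup {m} {ρ} {σ} cl =
  ∧-intro (∧-intro (any⁺ isIdentity (elems n) (elems-complete (F.zero , false)) refl)
                   (all⁺ _ (elems n) λ x _ → ⇒ᵇ-intro λ e → in-H x (identity x e)))
          (∧-intro (all⁺ _ (elems n) λ x _ → all⁺ _ (elems n) λ y _ → ⇒ᵇ-intro λ e →
                      in-H (mul x y) (mul-closed x y (out-H x (∧-elimˡ e)) (out-H y (∧-elimʳ {mem H x} e))))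
                   (all⁺ _ (elems n) λ x _ → ⇒ᵇ-intro λ e → in-H (inv x) (inv-closed x (out-H x e))))
  where
  n = suc m
  H : Sub n
  H = subset ρ σ
  open Closed cl

  in-H : ∀ x → memᴺ ρ σ x ≡ true → mem H x ≡ true
  in-H x = trans (mem-subset ρ σ x)

  out-H : ∀ x → mem H x ≡ true → memᴺ ρ σ x ≡ true
  out-H x = trans (sym (mem-subset ρ σ x))

  identity : ∀ x → isIdentity x ≡ true → memᴺ ρ σ x ≡ true
  identity (a , false) e rewrite ⌊⌋-sound (toℕ a ≟ 0) (∧-elimˡ e) = one
  identity (a , true) e with ∧-elimʳ {⌊ toℕ a ≟ 0 ⌋} e
  ... | ()

  mul-closed : ∀ x y → memᴺ ρ σ x ≡ true → memᴺ ρ σ y ≡ true → memᴺ ρ σ (mul x y) ≡ true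
  mul-closed (a , false) (c , false) ea ec rewrite toℕ-addF a c = rot·rot _ _ ea ec
  mul-closed (a , false) (c , true) ea ec rewrite toℕ-addF a c = rot·ref _ _ ea ec
  mul-closed (a , true) (c , false) ea ec rewrite toℕ-addF a (negF c) | toℕ-negF c = ref·rot _ _ (toℕ<n c) ea ec
  mul-closed (a , true) (c , true) ea ec rewrite toℕ-addF a (negF c) | toℕ-negF c = ref·ref _ _ (toℕ<n c) ea ec

  inv-closed : ∀ x → memᴺ ρ σ x ≡ true → memᴺ ρ σ (inv x) ≡ true
  inv-closed (a , false) ea rewrite toℕ-negF a = rot⁻¹ _ (toℕ<n a) ea
  inv-closed (a , true) ea = ea

residue : (d : ℕ) .{{_ : NonZero d}} → ℕ → ℕ → Bool
residue d i x = ⌊ x % d ≟ i ⌋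

residue-1 : ∀ x → residue 1 0 x ≡ true
residue-1 x = ⌊⌋-true (x % 1 ≟ 0) (n%1≡0 x)

residue-self : ∀ d .{{_ : NonZero d}} {x} → x < d → residue d x x ≡ true
residue-self d {x} x<d = ⌊⌋-true (x % d ≟ x) (m<n⇒m%n≡m x<d)

-- For d ∣ n these are the subgroups ⟨r^d⟩ and ⟨r^d, r^i s⟩ of D_{2n}.
module ResidueSubgroups {m : ℕ} (d : ℕ) .{{_ : NonZero d}} (d∣n : d ∣ suc m) where
  open Modular d
  open ≡-Reasoning

  private
    n = suc m

    %n%d : ∀ x → x % n % d ≡ x % d
    %n%d x = m∣n⇒o%n%m≡o%m d n x d∣n

    difference : ∀ a c → (a + (n ∸ c) % n) % n % d ≡ (a + (n ∸ c)) % d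
    difference a c = trans (%n%d _) (%-cong-+ {a} refl (%n%d (n ∸ c)))

    rotate : ∀ {a} c → a % d ≡ 0 → (a + c) % d ≡ c % d
    rotate c ea = %-cong-+ (trans ea (sym 0%d≡0)) refl

    mark : ∀ {x i} → x % d ≡ i → residue d i x ≡ true
    mark {x} {i} = ⌊⌋-true (x % d ≟ i)

    read : ∀ {x i} → residue d i x ≡ true → x % d ≡ i
    read {x} {i} = ⌊⌋-sound (x % d ≟ i)

    one : residue d 0 0 ≡ true
    one = mark 0%d≡0

    rot·x : ∀ a c {i} → residue d 0 a ≡ true → residue d i c ≡ true → residue d i ((a + c) % n) ≡ true
    rot·x a c ea ec = mark (trans (%n%d (a + c)) (trans (rotate c (read ea)) (read ec)))

    rot⁻¹ : ∀ a → a < n → residue d 0 a ≡ true → residue d 0 ((n ∸ a) % n) ≡ true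
    rot⁻¹ a a<n ea = mark (trans (%n%d (n ∸ a)) (trans (≡+c⇒+[n∸c]≡ d∣n 0 0 (<⇒≤ a<n) (trans 0%d≡0 (sym (read ea)))) 0%d≡0))

  cyclic-closed : Closed n (residue d 0) (λ _ → false)
  cyclic-closed = record
    { one = one ; rot·rot = λ a c → rot·x a c ; rot·ref = λ _ _ _ ()
    ; ref·rot = λ _ _ _ () ; ref·ref = λ _ _ _ () ; rot⁻¹ = rot⁻¹ }

  dihedral-closed : ∀ i → Closed n (residue d 0) (residue d i)
  dihedral-closed i = record
    { one = one ; rot·rot = λ a c → rot·x a c ; rot·ref = λ a c → rot·x a c
    ; ref·rot = ref·rot ; ref·ref = ref·ref ; rot⁻¹ = rot⁻¹ }
    where
    ref·rot : ∀ a c → c < n → residue d i a ≡ true → residue d 0 c ≡ true → residue d i ((a + (n ∸ c) % n) % n) ≡ true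
    ref·rot a c c<n ea ec = mark (begin
      (a + (n ∸ c) % n) % n % d  ≡⟨ difference a c ⟩
      (a + (n ∸ c)) % d          ≡⟨ ≡+c⇒+[n∸c]≡ d∣n a a (<⇒≤ c<n) a≡a+c ⟩
      a % d                      ≡⟨ read ea ⟩
      i                          ∎)
      where a≡a+c = sym (trans (cong (_% d) (+-comm a c)) (rotate a (read ec)))

    ref·ref : ∀ a c → c < n → residue d i a ≡ true → residue d i c ≡ true → residue d 0 ((a + (n ∸ c) % n) % n) ≡ true
    ref·ref a c c<n ea ec = mark (begin
      (a + (n ∸ c) % n) % n % d  ≡⟨ difference a c ⟩
      (a + (n ∸ c)) % d          ≡⟨ ≡+c⇒+[n∸c]≡ d∣n a 0 (<⇒≤ c<n) (trans (read ea) (sym (read ec))) ⟩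
      0 % d                      ≡⟨ 0%d≡0 ⟩
      0                          ∎)

module SubgroupFacts {m : ℕ} (R S : Vec Bool (suc m)) (sg : isSubgroup {suc m} (R , S) ≡ true) where
  private
    n = suc m
    H : Sub n
    H = R , S

    identity-closed : all (λ x → isIdentity x ⇒ᵇ mem H x) (elems n) ≡ true
    identity-closed = ∧-elimʳ {any isIdentity (elems n)} (∧-elimˡ sg)

    products-closed : all (λ x → all (λ y → (mem H x ∧ mem H y) ⇒ᵇ mem H (mul x y)) (elems n)) (elems n) ≡ true
    products-closed = ∧-elimˡ (∧-elimʳ {any isIdentity (elems n) ∧ all (λ x → isIdentity x ⇒ᵇ mem H x) (elems n)} sg)

    inverses-closed : all (λ x → mem H x ⇒ᵇ mem H (inv x)) (elems n) ≡ true
    inverses-closed = ∧-elimʳ {all (λ x → all (λ y → (mem H x ∧ mem H y) ⇒ᵇ mem H (mul x y)) (elems n)) (elems n)}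
                        (∧-elimʳ {any isIdentity (elems n) ∧ all (λ x → isIdentity x ⇒ᵇ mem H x) (elems n)} sg)

    mul-closed : ∀ x y → mem H x ≡ true → mem H y ≡ true → mem H (mul x y) ≡ true
    mul-closed x y ex ey = ⇒ᵇ-elim (all⁻ (λ y → (mem H x ∧ mem H y) ⇒ᵇ mem H (mul x y)) (elems n)
      (all⁻ (λ x → all (λ y → (mem H x ∧ mem H y) ⇒ᵇ mem H (mul x y)) (elems n)) (elems n) products-closed (elems-complete x))
      (elems-complete y)) (∧-intro ex ey)

    inv-closed : ∀ x → mem H x ≡ true → mem H (inv x) ≡ true
    inv-closed x = ⇒ᵇ-elim (all⁻ (λ x → mem H x ⇒ᵇ mem H (inv x)) (elems n) inverses-closed (elems-complete x))

  ρ σ : ℕ → Bool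
  ρ x = lookup R (x mod n)
  σ x = lookup S (x mod n)

  lookup-R : ∀ k → lookup R k ≡ ρ (toℕ k)
  lookup-R k = cong (lookup R) (sym (toℕ-mod-id k))

  lookup-S : ∀ k → lookup S k ≡ σ (toℕ k)
  lookup-S k = cong (lookup S) (sym (toℕ-mod-id k))

  ρ-cong : ∀ {x y} → x % n ≡ y % n → ρ x ≡ ρ y
  ρ-cong {x} {y} e = cong (lookup R) (mod-cong {x = x} {y = y} e)

  σ-cong : ∀ {x y} → x % n ≡ y % n → σ x ≡ σ y
  σ-cong {x} {y} e = cong (lookup S) (mod-cong {x = x} {y = y} e)

  ρ-zero : ρ 0 ≡ true
  ρ-zero = ⇒ᵇ-elim (all⁻ (λ x → isIdentity x ⇒ᵇ mem H x) (elems n) identity-closed (elems-complete (F.zero , false))) refl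

  ρ-+ : ∀ a b → ρ a ≡ true → ρ b ≡ true → ρ (a + b) ≡ true
  ρ-+ a b ea eb = subst (λ u → lookup R u ≡ true) (addF-mod a b) (mul-closed (a mod n , false) (b mod n , false) ea eb)

  ρσ-+ : ∀ a b → ρ a ≡ true → σ b ≡ true → σ (a + b) ≡ true
  ρσ-+ a b ea eb = subst (λ u → lookup S u ≡ true) (addF-mod a b) (mul-closed (a mod n , false) (b mod n , true) ea eb)

  σσ-∸ : ∀ a b → σ a ≡ true → σ b ≡ true → ρ (a + (n ∸ b % n)) ≡ true
  σσ-∸ a b ea eb = subst (λ u → lookup R u ≡ true)
    (trans (cong (addF (a mod n)) (negF-mod b)) (addF-mod a (n ∸ b % n)))
    (mul-closed (a mod n , true) (b mod n , true) ea eb)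

  ρ-∸ : ∀ a → ρ a ≡ true → ρ (n ∸ a % n) ≡ true
  ρ-∸ a ea = subst (λ u → lookup R u ≡ true) (negF-mod a) (inv-closed (a mod n , false) ea)

  ρ-* : ∀ t a → ρ a ≡ true → ρ (t * a) ≡ true
  ρ-* zero a ea = ρ-zero
  ρ-* (suc t) a ea = ρ-+ a (t * a) ea (ρ-* t a ea)

  -- By Bézout, ± gcd(a, n) is a multiple of a modulo n.
  ρ-gcd : ∀ a → ρ a ≡ true → ∃ λ d → d ∣ a × d ∣ n × ρ d ≡ true
  ρ-gcd a ea with Bézout.lemma a n
  ... | Bézout.result d g (Bézout.+- x y eq) =
    d , GCD.gcd∣m g , GCD.gcd∣n g ,
    trans (ρ-cong {d} {x * a} (trans (sym ([m+kn]%n≡m%n d y n)) (cong (_% n) eq))) (ρ-* x a ea)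
  ... | Bézout.result d g (Bézout.-+ x y eq) =
    d , GCD.gcd∣m g , GCD.gcd∣n g ,
    trans (ρ-cong {d} {n ∸ x * a % n} (sym negated)) (ρ-∸ (x * a) (ρ-* x a ea))
    where
    open Modular n
    negated : (n ∸ x * a % n) % n ≡ d % n
    negated = ≡+c⇒+[n∸c]≡ ∣-refl 0 d (m%n≤n (x * a) n) (begin
      0 % n                ≡⟨ m*n%n≡0 y n ⟨
      y * n % n            ≡⟨ cong (_% n) eq ⟨
      (d + x * a) % n      ≡⟨ %-cong-+ {d} {d} refl (m%n%n≡m%n (x * a) n) ⟨
      (d + x * a % n) % n  ∎)
      where open ≡-Reasoning

  reflection-shift⁺ : ∀ i k → lookup S i ≡ true → lookup S k ≡ true → ρ (toℕ k + (n ∸ toℕ i)) ≡ true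
  reflection-shift⁺ i k ei ek =
    subst (λ u → ρ (toℕ k + (n ∸ u)) ≡ true) (m<n⇒m%n≡m (toℕ<n i))
      (σσ-∸ (toℕ k) (toℕ i) (trans (sym (lookup-S k)) ek) (trans (sym (lookup-S i)) ei))

  reflection-shift⁻ : ∀ i k → lookup S i ≡ true → ρ (toℕ k + (n ∸ toℕ i)) ≡ true → lookup S k ≡ true
  reflection-shift⁻ i k ei eu = trans (lookup-S k)
    (trans (σ-cong {toℕ k} {toℕ k + (n ∸ toℕ i) + toℕ i} (sym (Modular.+-[n∸c]+c n ∣-refl (toℕ k) (<⇒≤ (toℕ<n i)))))
      (ρσ-+ (toℕ k + (n ∸ toℕ i)) (toℕ i) eu (trans (sym (lookup-S i)) ei)))

  reflections-determined : ∀ d .{{_ : NonZero d}} → d ∣ n → (∀ k → lookup R k ≡ residue d 0 (toℕ k)) →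
    ∀ i → lookup S i ≡ true → ∀ k → lookup S k ≡ residue d (toℕ i % d) (toℕ k)
  reflections-determined d d∣n R≗ i ei k = bool-ext to from
    where
    open Modular d
    i≤n = <⇒≤ (toℕ<n i)
    u = toℕ k + (n ∸ toℕ i)

    ρ≡residue : ∀ v → ρ v ≡ residue d 0 (v % n)
    ρ≡residue v = trans (R≗ (v mod n)) (cong (residue d 0) (toℕ-mod v))

    %n%d : ∀ v → v % n % d ≡ v % d
    %n%d v = m∣n⇒o%n%m≡o%m d n v d∣n

    to : lookup S k ≡ true → residue d (toℕ i % d) (toℕ k) ≡ true
    to ek = ⌊⌋-true (toℕ k % d ≟ toℕ i % d) (+[n∸c]≡⇒≡+c d∣n (toℕ k) 0 i≤n
      (trans (sym (%n%d u)) (trans (⌊⌋-sound (u % n % d ≟ 0) (trans (sym (ρ≡residue u)) (reflection-shift⁺ i k ei ek))) (sym 0%d≡0))))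

    from : residue d (toℕ i % d) (toℕ k) ≡ true → lookup S k ≡ true
    from e = reflection-shift⁻ i k ei (trans (ρ≡residue u) (⌊⌋-true (u % n % d ≟ 0)
      (trans (%n%d u) (trans (≡+c⇒+[n∸c]≡ d∣n (toℕ k) 0 i≤n (⌊⌋-sound (toℕ k % d ≟ toℕ i % d) e)) 0%d≡0))))

-- The proper non-trivial subgroups of D_{2p²}

module PrimeSquare (q : ℕ) where

  p N : ℕ
  p = suc (suc q)
  N = p ^ 2

  N≡p*p : N ≡ p * p
  N≡p*p = cong (p *_) (*-identityʳ p)

  p∣N : p ∣ N
  p∣N = divides p N≡p*p

  p<N : p < N
  p<N = subst (p <_) (sym N≡p*p) (m<m*n p p (s≤s (s≤s z≤n)))

  -- ⟨rⁱs⟩ j t below is ⟨r^i s⟩ for i = j + p t, the exponent written in base p.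
  idx : Fin p → Fin p → ℕ
  idx j t = toℕ j + p * toℕ t

  idx<N : ∀ j t → idx j t < N
  idx<N j t = begin-strict
    toℕ j + p * toℕ t  <⟨ +-monoˡ-< (p * toℕ t) (toℕ<n j) ⟩
    p + p * toℕ t      ≡⟨ *-suc p (toℕ t) ⟨
    p * suc (toℕ t)    ≤⟨ *-monoʳ-≤ p (toℕ<n t) ⟩
    p * p              ≡⟨ N≡p*p ⟨
    N                  ∎
    where open ≤-Reasoning

  rot ref : ℕ → Elem N
  rot k = k mod N , false
  ref k = k mod N , true

  data Code : Set where
    ⟨rᵖ⟩ ⟨r⟩ : Code
    ⟨rᵖ,rʲs⟩ : Fin p → Code
    ⟨rⁱs⟩ : Fin p → Fin p → Code

  rotationsOf reflectionsOf : Code → ℕ → Bool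
  rotationsOf ⟨rᵖ⟩ = residue p 0
  rotationsOf ⟨r⟩ = residue 1 0
  rotationsOf (⟨rᵖ,rʲs⟩ _) = residue p 0
  rotationsOf (⟨rⁱs⟩ _ _) = residue N 0
  reflectionsOf ⟨rᵖ⟩ _ = false
  reflectionsOf ⟨r⟩ _ = false
  reflectionsOf (⟨rᵖ,rʲs⟩ j) = residue p (toℕ j)
  reflectionsOf (⟨rⁱs⟩ j t) = residue N (idx j t)

  toSub : Code → Sub N
  toSub c = subset (rotationsOf c) (reflectionsOf c)

  memC : Code → Elem N → Bool
  memC c = memᴺ (rotationsOf c) (reflectionsOf c)

  ≡toSub : ∀ {R S} c → (∀ k → lookup R k ≡ rotationsOf c (toℕ k)) → (∀ k → lookup S k ≡ reflectionsOf c (toℕ k)) →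
           (R , S) ≡ toSub c
  ≡toSub c = subset-≡ {ρ = rotationsOf c} {σ = reflectionsOf c}

  mem-toSub : ∀ c x → mem (toSub c) x ≡ memC c x
  mem-toSub c = mem-subset (rotationsOf c) (reflectionsOf c)

  toSub-isSubgroup : ∀ c → isSubgroup (toSub c) ≡ true
  toSub-isSubgroup ⟨rᵖ⟩ = closed⇒isSubgroup (ResidueSubgroups.cyclic-closed p p∣N)
  toSub-isSubgroup ⟨r⟩ = closed⇒isSubgroup (ResidueSubgroups.cyclic-closed 1 (1∣ N))
  toSub-isSubgroup (⟨rᵖ,rʲs⟩ j) = closed⇒isSubgroup (ResidueSubgroups.dihedral-closed p p∣N (toℕ j))
  toSub-isSubgroup (⟨rⁱs⟩ j t) = closed⇒isSubgroup (ResidueSubgroups.dihedral-closed N ∣-refl (idx j t))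

  toℕ-mod< : ∀ {k} → k < N → toℕ (k mod N) ≡ k
  toℕ-mod< {k} k<N = trans (toℕ-mod k) (m<n⇒m%n≡m k<N)

  rᵖ : Elem N
  rᵖ = rot p

  rᵖ-nontrivial : isIdentity rᵖ ≡ false
  rᵖ-nontrivial = ∧-falseˡ (⌊⌋-false (toℕ (p mod N) ≟ 0) λ e → 1+n≢0 (trans (sym (toℕ-mod< p<N)) e))

  rᵖ∈ : ∀ c → rotationsOf c p ≡ true → memC c rᵖ ≡ true
  rᵖ∈ c e = trans (cong (rotationsOf c) (toℕ-mod< p<N)) e

  p-residue : residue p 0 p ≡ true
  p-residue = ⌊⌋-true (p % p ≟ 0) (n%n≡0 p)

  witness : Code → Elem N
  witness (⟨rᵖ,rʲs⟩ j) = ref (toℕ j)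
  witness (⟨rⁱs⟩ j t) = ref (idx j t)
  witness _ = rᵖ

  witness∈ : ∀ c → memC c (witness c) ≡ true
  witness∈ ⟨rᵖ⟩ = rᵖ∈ ⟨rᵖ⟩ p-residue
  witness∈ ⟨r⟩ = rᵖ∈ ⟨r⟩ (residue-1 p)
  witness∈ (⟨rᵖ,rʲs⟩ j) = trans (cong (residue p (toℕ j)) (toℕ-mod< (<-trans (toℕ<n j) p<N))) (residue-self p (toℕ<n j))
  witness∈ (⟨rⁱs⟩ j t) = trans (cong (residue N (idx j t)) (toℕ-mod< (idx<N j t))) (residue-self N (idx<N j t))

  witness-nontrivial : ∀ c → isIdentity (witness c) ≡ false
  witness-nontrivial ⟨rᵖ⟩ = rᵖ-nontrivial
  witness-nontrivial ⟨r⟩ = rᵖ-nontrivial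
  witness-nontrivial (⟨rᵖ,rʲs⟩ j) = ∧-falseʳ {⌊ toℕ (toℕ j mod N) ≟ 0 ⌋} refl
  witness-nontrivial (⟨rⁱs⟩ j t) = ∧-falseʳ {⌊ toℕ (idx j t mod N) ≟ 0 ⌋} refl

  outside : Code → Elem N
  outside ⟨r⟩ = F.zero , true
  outside _ = F.suc F.zero , false

  outside∉ : ∀ c → memC c (outside c) ≡ false
  outside∉ ⟨rᵖ⟩ = refl
  outside∉ ⟨r⟩ = refl
  outside∉ (⟨rᵖ,rʲs⟩ _) = refl
  outside∉ (⟨rⁱs⟩ _ _) = refl

  toSub∈vertices : ∀ c → toSub c ∈ vertices N
  toSub∈vertices c = ∈-filter⁺ (λ H → isVertex H B.≟ true) (allSubs-complete (toSub c))
    (∧-intro (toSub-isSubgroup c) (∧-intro proper nontrivial))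
    where
    proper : isProper (toSub c) ≡ true
    proper = any⁺ (λ x → not (mem (toSub c) x)) (elems N) (elems-complete (outside c))
      (trans (cong not (mem-toSub c (outside c))) (≡false⇒not≡true (outside∉ c)))
    nontrivial : isNontrivial (toSub c) ≡ true
    nontrivial = any⁺ (λ x → not (isIdentity x) ∧ mem (toSub c) x) (elems N) (elems-complete (witness c))
      (∧-intro (≡false⇒not≡true (witness-nontrivial c)) (trans (mem-toSub c (witness c)) (witness∈ c)))

  memC-ref : ∀ c {k} → k < N → memC c (ref k) ≡ reflectionsOf c k
  memC-ref c k<N = cong (reflectionsOf c) (toℕ-mod< k<N)

  rᵖ∉⟨rⁱs⟩ : ∀ j t → memC (⟨rⁱs⟩ j t) rᵖ ≡ false
  rᵖ∉⟨rⁱs⟩ j t = ⌊⌋-false (toℕ (p mod N) % N ≟ 0) λ e →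
    1+n≢0 (trans (sym (m<n⇒m%n≡m p<N)) (subst (λ u → u % N ≡ 0) (toℕ-mod< p<N) e))

  idx%p : ∀ j t → idx j t % p ≡ toℕ j
  idx%p j t = trans (cong (λ u → (toℕ j + u) % p) (*-comm p (toℕ t)))
                    (trans ([m+kn]%n≡m%n (toℕ j) (toℕ t) p) (m<n⇒m%n≡m (toℕ<n j)))

  idx-injective : ∀ {j t j′ t′} → idx j t ≡ idx j′ t′ → ⟨rⁱs⟩ j t ≡ ⟨rⁱs⟩ j′ t′
  idx-injective {j} {t} {j′} {t′} e with toℕ-injective (trans (sym (idx%p j t)) (trans (cong (_% p) e) (idx%p j′ t′)))
  ... | refl = cong (⟨rⁱs⟩ j) (toℕ-injective (*-cancelˡ-≡ (toℕ t) (toℕ t′) p (+-cancelˡ-≡ (toℕ j) _ _ e)))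

  toSub-injective : ∀ {c c′} → toSub c ≡ toSub c′ → c ≡ c′
  toSub-injective {c} {c′} eq = same-members c c′ λ x →
    trans (sym (mem-toSub c x)) (trans (cong (λ H → mem H x) eq) (mem-toSub c′ x))
    where
    witness∈′ : ∀ {c c′} → (∀ x → memC c x ≡ memC c′ x) → memC c′ (witness c) ≡ true
    witness∈′ {c} same = trans (sym (same (witness c))) (witness∈ c)

    reflection-free : ∀ {c c′} → (∀ x → memC c x ≡ memC c′ x) → memC c (witness c′) ≡ false → c ≡ c′
    reflection-free {c′ = c′} same e = ⊥-elim (true≢false (witness∈ c′) (trans (sym (same (witness c′))) e))

    same-members : ∀ c c′ → (∀ x → memC c x ≡ memC c′ x) → c ≡ c′
    same-members ⟨rᵖ⟩ ⟨rᵖ⟩ _ = refl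
    same-members ⟨rᵖ⟩ ⟨r⟩ same with same (F.suc F.zero , false)
    ... | ()
    same-members ⟨rᵖ⟩ (⟨rᵖ,rʲs⟩ _) same = reflection-free same refl
    same-members ⟨rᵖ⟩ (⟨rⁱs⟩ _ _) same = reflection-free same refl
    same-members ⟨r⟩ ⟨rᵖ⟩ same with same (F.suc F.zero , false)
    ... | ()
    same-members ⟨r⟩ ⟨r⟩ _ = refl
    same-members ⟨r⟩ (⟨rᵖ,rʲs⟩ _) same = reflection-free same refl
    same-members ⟨r⟩ (⟨rⁱs⟩ _ _) same = reflection-free same refl
    same-members (⟨rᵖ,rʲs⟩ _) ⟨rᵖ⟩ same = sym (reflection-free (sym ∘ same) refl)
    same-members (⟨rᵖ,rʲs⟩ _) ⟨r⟩ same = sym (reflection-free (sym ∘ same) refl)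
    same-members c@(⟨rᵖ,rʲs⟩ j) c′@(⟨rᵖ,rʲs⟩ j′) same = cong ⟨rᵖ,rʲs⟩ (toℕ-injective (trans (sym (m<n⇒m%n≡m (toℕ<n j)))
      (⌊⌋-sound (toℕ j % p ≟ toℕ j′) (trans (sym (memC-ref c′ (<-trans (toℕ<n j) p<N))) (witness∈′ {c} {c′} same)))))
    same-members (⟨rᵖ,rʲs⟩ j) (⟨rⁱs⟩ j′ t) same =
      ⊥-elim (true≢false (trans (sym (same rᵖ)) (rᵖ∈ (⟨rᵖ,rʲs⟩ j) p-residue)) (rᵖ∉⟨rⁱs⟩ j′ t))
    same-members (⟨rⁱs⟩ _ _) ⟨rᵖ⟩ same = sym (reflection-free (sym ∘ same) refl)
    same-members (⟨rⁱs⟩ _ _) ⟨r⟩ same = sym (reflection-free (sym ∘ same) refl)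
    same-members (⟨rⁱs⟩ j t) (⟨rᵖ,rʲs⟩ j′) same =
      ⊥-elim (true≢false (trans (same rᵖ) (rᵖ∈ (⟨rᵖ,rʲs⟩ j′) p-residue)) (rᵖ∉⟨rⁱs⟩ j t))
    same-members c@(⟨rⁱs⟩ j t) c′@(⟨rⁱs⟩ j′ t′) same = idx-injective (trans (sym (m<n⇒m%n≡m (idx<N j t)))
      (⌊⌋-sound (idx j t % N ≟ idx j′ t′) (trans (sym (memC-ref c′ (idx<N j t))) (witness∈′ {c} {c′} same))))

  reflectionRow : Fin p → List Code
  reflectionRow j = map (⟨rⁱs⟩ j) (allFin p)

  dihedralCodes reflectionCodes : List Code
  dihedralCodes = map ⟨rᵖ,rʲs⟩ (allFin p)
  reflectionCodes = concatMap reflectionRow (allFin p)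

  codes : List Code
  codes = ⟨rᵖ⟩ ∷ ⟨r⟩ ∷ dihedralCodes ++ reflectionCodes

  codes-complete : ∀ c → c ∈ codes
  codes-complete ⟨rᵖ⟩ = here refl
  codes-complete ⟨r⟩ = there (here refl)
  codes-complete (⟨rᵖ,rʲs⟩ j) = there (there (∈-++⁺ˡ (∈-map⁺ ⟨rᵖ,rʲs⟩ (∈-allFin j))))
  codes-complete (⟨rⁱs⟩ j t) =
    there (there (∈-++⁺ʳ dihedralCodes (∈-concatMap⁺′ reflectionRow (∈-allFin j) (∈-map⁺ (⟨rⁱs⟩ j) (∈-allFin t)))))

  ∈dihedralCodes⁻ : ∀ {c} → c ∈ dihedralCodes → ∃ λ j → c ≡ ⟨rᵖ,rʲs⟩ j
  ∈dihedralCodes⁻ m = let j , _ , e = ∈-map⁻ ⟨rᵖ,rʲs⟩ m in j , e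

  ∈reflectionCodes⁻ : ∀ {c} → c ∈ reflectionCodes → ∃ λ j → ∃ λ t → c ≡ ⟨rⁱs⟩ j t
  ∈reflectionCodes⁻ m with ∈-concatMap⁻′ reflectionRow {xs = allFin p} m
  ... | j , _ , m′ = let t , _ , e = ∈-map⁻ (⟨rⁱs⟩ j) m′ in j , t , e

  codes-unique : Unique codes
  codes-unique =
    All.tabulate ⟨rᵖ⟩∉ ∷ All.tabulate (⟨r⟩∉ ∘ ∈-++⁻ dihedralCodes) ∷
    Unique.++⁺ (Unique.map⁺ (λ { refl → refl }) (Unique.allFin⁺ p))
               (concatMap-unique reflectionRow (Unique.allFin⁺ p) (λ j → Unique.map⁺ (λ { refl → refl }) (Unique.allFin⁺ p)) same-row)
               disjoint
    where
    ⟨r⟩∉ : ∀ {c} → c ∈ dihedralCodes ⊎ c ∈ reflectionCodes → ⟨r⟩ ≢ c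
    ⟨r⟩∉ (inj₁ m) refl with ∈dihedralCodes⁻ m
    ... | _ , ()
    ⟨r⟩∉ (inj₂ m) refl with ∈reflectionCodes⁻ m
    ... | _ , _ , ()
    ⟨rᵖ⟩∉ : ∀ {c} → c ∈ ⟨r⟩ ∷ dihedralCodes ++ reflectionCodes → ⟨rᵖ⟩ ≢ c
    ⟨rᵖ⟩∉ (here refl) ()
    ⟨rᵖ⟩∉ (there m) refl with ∈-++⁻ dihedralCodes m
    ... | inj₁ m₁ with ∈dihedralCodes⁻ m₁
    ...   | _ , ()
    ⟨rᵖ⟩∉ (there m) refl | inj₂ m₂ with ∈reflectionCodes⁻ m₂
    ...   | _ , _ , ()
    same-row : ∀ {j j′ c} → c ∈ reflectionRow j → c ∈ reflectionRow j′ → j ≡ j′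
    same-row {j} {j′} m m′ with ∈-map⁻ (⟨rⁱs⟩ j) m | ∈-map⁻ (⟨rⁱs⟩ j′) m′
    ... | _ , _ , refl | _ , _ , refl = refl
    disjoint : ∀ {c} → c ∈ dihedralCodes × c ∈ reflectionCodes → ⊥
    disjoint (m , m′) with ∈dihedralCodes⁻ m | ∈reflectionCodes⁻ m′
    ... | _ , refl | _ , _ , ()

  -- All subgroups but the ⟨r^i s⟩ contain r^p, and ⟨r^i s⟩ meets only ⟨r^p, r^(i mod p) s⟩.
  adjacentC : Code → Code → Bool
  adjacentC (⟨rⁱs⟩ j _) (⟨rᵖ,rʲs⟩ j′) = ⌊ j F.≟ j′ ⌋
  adjacentC (⟨rᵖ,rʲs⟩ j) (⟨rⁱs⟩ j′ _) = ⌊ j F.≟ j′ ⌋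
  adjacentC (⟨rⁱs⟩ _ _) _ = false
  adjacentC _ (⟨rⁱs⟩ _ _) = false
  adjacentC (⟨rᵖ,rʲs⟩ j) (⟨rᵖ,rʲs⟩ j′) = not ⌊ j F.≟ j′ ⌋
  adjacentC ⟨rᵖ⟩ ⟨rᵖ⟩ = false
  adjacentC ⟨r⟩ ⟨r⟩ = false
  adjacentC _ _ = true

  rᵖ-shared : ∀ c c′ → c ≢ c′ → rotationsOf c p ≡ true → rotationsOf c′ p ≡ true → adj (toSub c) (toSub c′) ≡ true
  rᵖ-shared c c′ c≢c′ e e′ = adj-intro rᵖ (c≢c′ ∘ toSub-injective) rᵖ-nontrivial
    (trans (mem-toSub c rᵖ) (rᵖ∈ c e)) (trans (mem-toSub c′ rᵖ) (rᵖ∈ c′ e′))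

  ⟨rⁱs⟩-isolated : ∀ j t c → reflectionsOf c (idx j t) ≡ false →
                   ∀ x → isIdentity x ≡ false → memC (⟨rⁱs⟩ j t) x ≡ true → memC c x ≡ true → ⊥
  ⟨rⁱs⟩-isolated j t c _ (k , false) nid e _ = true≢false (∧-intro (⌊⌋-true (toℕ k ≟ 0) k≡0) refl) nid
    where k≡0 = trans (sym (m<n⇒m%n≡m (toℕ<n k))) (⌊⌋-sound (toℕ k % N ≟ 0) e)
  ⟨rⁱs⟩-isolated j t c idx∉ (k , true) _ e e′ = true≢false (subst (λ u → reflectionsOf c u ≡ true) k≡idx e′) idx∉
    where k≡idx = trans (sym (m<n⇒m%n≡m (toℕ<n k))) (⌊⌋-sound (toℕ k % N ≟ idx j t) e)

  adj-⟨rⁱs⟩-false : ∀ j t c → reflectionsOf c (idx j t) ≡ false → adj (toSub (⟨rⁱs⟩ j t)) (toSub c) ≡ false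
  adj-⟨rⁱs⟩-false j t c idx∉ = adj-false λ x nid e e′ →
    ⟨rⁱs⟩-isolated j t c idx∉ x nid (trans (sym (mem-toSub (⟨rⁱs⟩ j t) x)) e) (trans (sym (mem-toSub c x)) e′)

  adj-⟨rⁱs⟩ : ∀ j t c → adj (toSub (⟨rⁱs⟩ j t)) (toSub c) ≡ adjacentC (⟨rⁱs⟩ j t) c
  adj-⟨rⁱs⟩ j t ⟨rᵖ⟩ = adj-⟨rⁱs⟩-false j t ⟨rᵖ⟩ refl
  adj-⟨rⁱs⟩ j t ⟨r⟩ = adj-⟨rⁱs⟩-false j t ⟨r⟩ refl
  adj-⟨rⁱs⟩ j t (⟨rᵖ,rʲs⟩ j′) with j F.≟ j′
  ... | yes refl = adj-intro (witness (⟨rⁱs⟩ j t)) (distinct ∘ toSub-injective) (witness-nontrivial (⟨rⁱs⟩ j t))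
    (trans (mem-toSub (⟨rⁱs⟩ j t) (witness (⟨rⁱs⟩ j t))) (witness∈ (⟨rⁱs⟩ j t)))
    (trans (mem-toSub (⟨rᵖ,rʲs⟩ j) (witness (⟨rⁱs⟩ j t)))
      (trans (memC-ref (⟨rᵖ,rʲs⟩ j) (idx<N j t)) (⌊⌋-true (idx j t % p ≟ toℕ j) (idx%p j t))))
    where
    distinct : ⟨rⁱs⟩ j t ≢ ⟨rᵖ,rʲs⟩ j
    distinct ()
  ... | no j≢j′ = adj-⟨rⁱs⟩-false j t (⟨rᵖ,rʲs⟩ j′)
    (⌊⌋-false (idx j t % p ≟ toℕ j′) λ e → j≢j′ (toℕ-injective (trans (sym (idx%p j t)) e)))
  adj-⟨rⁱs⟩ j t (⟨rⁱs⟩ j′ t′) with idx j t ≟ idx j′ t′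
  ... | yes e with idx-injective {j} {t} {j′} {t′} e
  ...   | refl = adj-self (toSub (⟨rⁱs⟩ j t))
  adj-⟨rⁱs⟩ j t (⟨rⁱs⟩ j′ t′) | no idx≢ = adj-⟨rⁱs⟩-false j t (⟨rⁱs⟩ j′ t′)
    (⌊⌋-false (idx j t % N ≟ idx j′ t′) λ e → idx≢ (trans (sym (m<n⇒m%n≡m (idx<N j t))) e))

  adj≡ : ∀ c c′ → adj (toSub c) (toSub c′) ≡ adjacentC c c′
  adj≡ (⟨rⁱs⟩ j t) c′ = adj-⟨rⁱs⟩ j t c′
  adj≡ c@⟨rᵖ⟩ (⟨rⁱs⟩ j t) = trans (adj-sym (toSub c) (toSub (⟨rⁱs⟩ j t))) (adj-⟨rⁱs⟩ j t c)
  adj≡ c@⟨r⟩ (⟨rⁱs⟩ j t) = trans (adj-sym (toSub c) (toSub (⟨rⁱs⟩ j t))) (adj-⟨rⁱs⟩ j t c)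
  adj≡ c@(⟨rᵖ,rʲs⟩ j′) (⟨rⁱs⟩ j t) =
    trans (adj-sym (toSub c) (toSub (⟨rⁱs⟩ j t))) (trans (adj-⟨rⁱs⟩ j t c) (⌊≟⌋-sym j j′))
  adj≡ c@⟨rᵖ⟩ ⟨rᵖ⟩ = adj-self (toSub c)
  adj≡ c@⟨rᵖ⟩ c′@⟨r⟩ = rᵖ-shared c c′ (λ ()) p-residue (residue-1 p)
  adj≡ c@⟨rᵖ⟩ c′@(⟨rᵖ,rʲs⟩ _) = rᵖ-shared c c′ (λ ()) p-residue p-residue
  adj≡ c@⟨r⟩ c′@⟨rᵖ⟩ = rᵖ-shared c c′ (λ ()) (residue-1 p) p-residue
  adj≡ c@⟨r⟩ ⟨r⟩ = adj-self (toSub c)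
  adj≡ c@⟨r⟩ c′@(⟨rᵖ,rʲs⟩ _) = rᵖ-shared c c′ (λ ()) (residue-1 p) p-residue
  adj≡ c@(⟨rᵖ,rʲs⟩ _) c′@⟨rᵖ⟩ = rᵖ-shared c c′ (λ ()) p-residue p-residue
  adj≡ c@(⟨rᵖ,rʲs⟩ _) c′@⟨r⟩ = rᵖ-shared c c′ (λ ()) p-residue (residue-1 p)
  adj≡ c@(⟨rᵖ,rʲs⟩ j) c′@(⟨rᵖ,rʲs⟩ j′) with j F.≟ j′
  ... | yes refl = adj-self (toSub c)
  ... | no j≢j′ = rᵖ-shared c c′ (λ { refl → j≢j′ refl }) p-residue p-residue

  idx-surjective : ∀ {i} → i < N → ∃ λ j → ∃ λ t → idx j t ≡ i
  idx-surjective {i} i<N = fromℕ< (m%n<n i p) , fromℕ< i/p<p , (begin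
    toℕ (fromℕ< (m%n<n i p)) + p * toℕ (fromℕ< i/p<p)
      ≡⟨ cong₂ (λ u v → u + p * v) (toℕ-fromℕ< (m%n<n i p)) (toℕ-fromℕ< i/p<p) ⟩
    i % p + p * (i / p)                                ≡⟨ cong (i % p +_) (*-comm p (i / p)) ⟩
    i % p + i / p * p                                  ≡⟨ m≡m%n+[m/n]*n i p ⟨
    i                                                  ∎)
    where
    open ≡-Reasoning
    i/p<p = m<n*o⇒m/o<n {i} {p} {p} (subst (i <_) N≡p*p i<N)

  δ : Code → Code → ℕ
  δ (⟨rⁱs⟩ j t) (⟨rⁱs⟩ j′ t′) = if ⌊ j F.≟ j′ ⌋ then (if ⌊ t F.≟ t′ ⌋ then 0 else 2) else 3
  δ (⟨rⁱs⟩ j _) (⟨rᵖ,rʲs⟩ j′) = if ⌊ j F.≟ j′ ⌋ then 1 else 2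
  δ (⟨rᵖ,rʲs⟩ j) (⟨rⁱs⟩ j′ _) = if ⌊ j F.≟ j′ ⌋ then 1 else 2
  δ (⟨rⁱs⟩ _ _) _ = 2
  δ _ (⟨rⁱs⟩ _ _) = 2
  δ (⟨rᵖ,rʲs⟩ j) (⟨rᵖ,rʲs⟩ j′) = if ⌊ j F.≟ j′ ⌋ then 0 else 1
  δ ⟨rᵖ⟩ ⟨rᵖ⟩ = 0
  δ ⟨r⟩ ⟨r⟩ = 0
  δ _ _ = 1

  δ-sym : ∀ c c′ → δ c c′ ≡ δ c′ c
  δ-sym ⟨rᵖ⟩ ⟨rᵖ⟩ = refl
  δ-sym ⟨rᵖ⟩ ⟨r⟩ = refl
  δ-sym ⟨rᵖ⟩ (⟨rᵖ,rʲs⟩ _) = refl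
  δ-sym ⟨rᵖ⟩ (⟨rⁱs⟩ _ _) = refl
  δ-sym ⟨r⟩ ⟨rᵖ⟩ = refl
  δ-sym ⟨r⟩ ⟨r⟩ = refl
  δ-sym ⟨r⟩ (⟨rᵖ,rʲs⟩ _) = refl
  δ-sym ⟨r⟩ (⟨rⁱs⟩ _ _) = refl
  δ-sym (⟨rᵖ,rʲs⟩ _) ⟨rᵖ⟩ = refl
  δ-sym (⟨rᵖ,rʲs⟩ _) ⟨r⟩ = refl
  δ-sym (⟨rᵖ,rʲs⟩ j) (⟨rᵖ,rʲs⟩ j′) = cong (if_then 0 else 1) (⌊≟⌋-sym j j′)
  δ-sym (⟨rᵖ,rʲs⟩ j) (⟨rⁱs⟩ j′ _) = cong (if_then 1 else 2) (⌊≟⌋-sym j j′)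
  δ-sym (⟨rⁱs⟩ _ _) ⟨rᵖ⟩ = refl
  δ-sym (⟨rⁱs⟩ _ _) ⟨r⟩ = refl
  δ-sym (⟨rⁱs⟩ j _) (⟨rᵖ,rʲs⟩ j′) = cong (if_then 1 else 2) (⌊≟⌋-sym j j′)
  δ-sym (⟨rⁱs⟩ j t) (⟨rⁱs⟩ j′ t′) =
    cong₂ (λ b b′ → if b then (if b′ then 0 else 2) else 3) (⌊≟⌋-sym j j′) (⌊≟⌋-sym t t′)

  δ-diagonal : ∀ c → δ c c ≡ 0
  δ-diagonal ⟨rᵖ⟩ = refl
  δ-diagonal ⟨r⟩ = refl
  δ-diagonal (⟨rᵖ,rʲs⟩ j) = if-true (⌊≟⌋-refl j)
  δ-diagonal (⟨rⁱs⟩ j t) = trans (if-true (⌊≟⌋-refl j)) (if-true (⌊≟⌋-refl t))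

  -- 2 WW is the sum of d + d² over ordered pairs of vertices.
  d+d² : ℕ → ℕ
  d+d² d = d + d * d

  sum-codes : ∀ (g : Code → ℕ) →
    sum (map g codes) ≡ g ⟨rᵖ⟩ + (g ⟨r⟩ + (sumFin p (g ∘ ⟨rᵖ,rʲs⟩) + sumFin p (λ j → sumFin p (g ∘ ⟨rⁱs⟩ j))))
  sum-codes g = cong (λ u → g ⟨rᵖ⟩ + (g ⟨r⟩ + u)) (trans (sum-map-++ g dihedralCodes reflectionCodes)
    (cong₂ _+_ (sum-map-∘ g ⟨rᵖ,rʲs⟩ (allFin p))
               (trans (sum-concatMap g reflectionRow (allFin p)) (sum-cong (allFin p) λ j → sum-map-∘ g (⟨rⁱs⟩ j) (allFin p)))))

  rowSum : Code → ℕ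
  rowSum c = sum (map (λ c′ → d+d² (δ c c′)) codes)

  m : ℕ
  m = suc q

  row-cyclic row-dihedral row-reflection : ℕ
  row-cyclic = 2 + (p * 2 + p * (p * 6))
  row-dihedral = 2 + (2 + ((0 + m * 2) + (p * 2 + m * (p * 6))))
  row-reflection = 6 + (6 + ((2 + m * 6) + ((0 + m * 6) + m * (p * 12))))

  rowSum-⟨rᵖ⟩ : rowSum ⟨rᵖ⟩ ≡ row-cyclic
  rowSum-⟨rᵖ⟩ = trans (sum-codes (λ c′ → d+d² (δ ⟨rᵖ⟩ c′))) (cong₂ (λ u v → 2 + (u + v)) (sumFin-const p 2)
    (trans (sum-cong (allFin p) λ _ → sumFin-const p 6) (sumFin-const p (p * 6))))

  rowSum-⟨r⟩ : rowSum ⟨r⟩ ≡ row-cyclic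
  rowSum-⟨r⟩ = trans (sum-codes (λ c′ → d+d² (δ ⟨r⟩ c′))) (cong₂ (λ u v → 2 + (u + v)) (sumFin-const p 2)
    (trans (sum-cong (allFin p) λ _ → sumFin-const p 6) (sumFin-const p (p * 6))))

  rowSum-⟨rᵖ,rʲs⟩ : ∀ j → rowSum (⟨rᵖ,rʲs⟩ j) ≡ row-dihedral
  rowSum-⟨rᵖ,rʲs⟩ j = trans (sum-codes (λ c′ → d+d² (δ (⟨rᵖ,rʲs⟩ j) c′))) (cong₂ (λ u v → 2 + (2 + (u + v)))
    (trans (sum-cong (allFin p) λ j′ → if-float d+d² ⌊ j F.≟ j′ ⌋) (sumFin-indicator m j 0 2))
    (trans (sum-cong (allFin p) λ j′ → trans (sum-cong (allFin p) λ _ → if-float d+d² ⌊ j F.≟ j′ ⌋) (sumFin-const-if j′))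
           (sumFin-indicator m j (p * 2) (p * 6))))
    where
    sumFin-const-if : ∀ j′ → sumFin p (λ _ → if ⌊ j F.≟ j′ ⌋ then 2 else 6) ≡ (if ⌊ j F.≟ j′ ⌋ then p * 2 else p * 6)
    sumFin-const-if j′ with ⌊ j F.≟ j′ ⌋
    ... | true = sumFin-const p 2
    ... | false = sumFin-const p 6

  rowSum-⟨rⁱs⟩ : ∀ j t → rowSum (⟨rⁱs⟩ j t) ≡ row-reflection
  rowSum-⟨rⁱs⟩ j t = trans (sum-codes (λ c′ → d+d² (δ (⟨rⁱs⟩ j t) c′))) (cong₂ (λ u v → 6 + (6 + (u + v)))
    (trans (sum-cong (allFin p) λ j′ → if-float d+d² ⌊ j F.≟ j′ ⌋) (sumFin-indicator m j 2 6))
    (trans (sum-cong (allFin p) reflection-row) (sumFin-indicator m j (0 + m * 6) (p * 12))))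
    where
    reflection-row : ∀ j′ → sumFin p (λ t′ → d+d² (δ (⟨rⁱs⟩ j t) (⟨rⁱs⟩ j′ t′)))
                            ≡ (if ⌊ j F.≟ j′ ⌋ then 0 + m * 6 else p * 12)
    reflection-row j′ with ⌊ j F.≟ j′ ⌋
    ... | true = trans (sum-cong (allFin p) λ t′ → if-float d+d² ⌊ t F.≟ t′ ⌋) (sumFin-indicator m t 0 6)
    ... | false = sumFin-const p 12

  ΣΣ-d+d² : ΣΣ codes (λ c c′ → d+d² (δ c c′)) ≡ row-cyclic + (row-cyclic + (p * row-dihedral + p * (p * row-reflection)))
  ΣΣ-d+d² = trans (sum-codes rowSum) (cong₂ _+_ rowSum-⟨rᵖ⟩ (cong₂ _+_ rowSum-⟨r⟩ (cong₂ _+_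
    (trans (sum-cong (allFin p) rowSum-⟨rᵖ,rʲs⟩) (sumFin-const p row-dihedral))
    (trans (sum-cong (allFin p) λ j → trans (sum-cong (allFin p) (rowSum-⟨rⁱs⟩ j)) (sumFin-const p row-reflection))
           (sumFin-const p (p * row-reflection))))))

  -- A ring identity in x = p − 2.
  ΣΣ-d+d²-value : row-cyclic + (row-cyclic + (p * row-dihedral + p * (p * row-reflection)))
                  ≡ 2 * (6 * p ^ 4 + 3 * p ^ 3 + 6 * p ^ 2 + 3 * p + 2)
  ΣΣ-d+d²-value = polynomial q
    where
    polynomial : ∀ x →
      (2 + ((2 + x) * 2 + (2 + x) * ((2 + x) * 6))) + ((2 + ((2 + x) * 2 + (2 + x) * ((2 + x) * 6)))
        + ((2 + x) * (2 + (2 + ((0 + (1 + x) * 2) + ((2 + x) * 2 + (1 + x) * ((2 + x) * 6)))))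
          + (2 + x) * ((2 + x) * (6 + (6 + ((2 + (1 + x) * 6) + ((0 + (1 + x) * 6) + (1 + x) * ((2 + x) * 12))))))))
      ≡ 2 * (6 * ((2 + x) * ((2 + x) * ((2 + x) * ((2 + x) * 1)))) + 3 * ((2 + x) * ((2 + x) * ((2 + x) * 1)))
             + 6 * ((2 + x) * ((2 + x) * 1)) + 3 * (2 + x) + 2)
    polynomial = solve-∀

divisors-of-square : ∀ {p d} → Prime p → d ∣ p * p → d ≡ 1 ⊎ d ≡ p ⊎ d ≡ p * p
divisors-of-square {p} {d} pr d∣pp with p ∣? d
... | yes (divides e d≡e*p) with prime⇒irreducible pr {e} (*-cancelʳ-∣ p {{prime⇒nonZero pr}} (subst (_∣ p * p) d≡e*p d∣pp))
...   | inj₁ refl = inj₂ (inj₁ (trans d≡e*p (+-identityʳ p)))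
...   | inj₂ refl = inj₂ (inj₂ d≡e*p)
divisors-of-square {p} {d} pr d∣pp | no p∤d with prime⇒irreducible pr {d} (coprime-divisor coprime d∣pp)
  where
  coprime : Coprime d p
  coprime (i∣d , i∣p) with prime⇒irreducible pr i∣p
  ... | inj₁ i≡1 = i≡1
  ... | inj₂ refl = ⊥-elim (p∤d i∣d)
... | inj₁ d≡1 = inj₁ d≡1
... | inj₂ refl = ⊥-elim (p∤d ∣-refl)

module Classification (q : ℕ) (prime : Prime (suc (suc q))) where
  open PrimeSquare q

  module _ (R S : Vec Bool N) (sg : isSubgroup (R , S) ≡ true) where
    open SubgroupFacts R S sg

    data RotationPart : Set where
      all-rotations : (∀ k → lookup R k ≡ residue 1 0 (toℕ k)) → RotationPart
      multiples-of-p : (∀ k → lookup R k ≡ residue p 0 (toℕ k)) → RotationPart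
      identity-only : (∀ k → lookup R k ≡ residue N 0 (toℕ k)) → RotationPart

    private
      r∈⇒all-rotations : ρ 1 ≡ true → RotationPart
      r∈⇒all-rotations ρ1 = all-rotations λ k → trans (lookup-R k)
        (trans (cong ρ (sym (*-identityʳ (toℕ k)))) (trans (ρ-* (toℕ k) 1 ρ1) (sym (residue-1 (toℕ k)))))

      rᵖ∈⇒rotationPart : ρ p ≡ true → RotationPart
      rᵖ∈⇒rotationPart ρp with any? (λ k → (lookup R k B.≟ true) ×-dec ¬? (p ∣? toℕ k))
      ... | yes (k , ek , p∤k) with ρ-gcd (toℕ k) (trans (sym (lookup-R k)) ek)
      ...   | d , d∣k , d∣N , ρd with divisors-of-square prime (subst (d ∣_) N≡p*p d∣N)
      ...     | inj₁ refl = r∈⇒all-rotations ρd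
      ...     | inj₂ (inj₁ refl) = ⊥-elim (p∤k d∣k)
      ...     | inj₂ (inj₂ refl) = ⊥-elim (p∤k (∣-trans (divides p refl) d∣k))
      rᵖ∈⇒rotationPart ρp | no none = multiples-of-p λ k → bool-ext
        (λ e → ⌊⌋-true (toℕ k % p ≟ 0)
                 (n∣m⇒m%n≡0 (toℕ k) p (decidable-stable (p ∣? toℕ k) (λ p∤k → none (k , e , p∤k)))))
        (λ e → trans (lookup-R k) (trans (cong ρ (sym (m/n*n≡m (m%n≡0⇒n∣m (toℕ k) p (⌊⌋-sound (toℕ k % p ≟ 0) e)))))
                                        (ρ-* (toℕ k / p) p ρp)))

    rotationPart : RotationPart
    rotationPart with any? (λ k → (lookup R k B.≟ true) ×-dec ¬? (toℕ k ≟ 0))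
    ... | no none = identity-only λ k → bool-ext
      (λ e → ⌊⌋-true (toℕ k % N ≟ 0)
               (trans (m<n⇒m%n≡m (toℕ<n k)) (decidable-stable (toℕ k ≟ 0) (λ k≢0 → none (k , e , k≢0)))))
      (λ e → trans (lookup-R k) (trans (cong ρ (trans (sym (m<n⇒m%n≡m (toℕ<n k))) (⌊⌋-sound (toℕ k % N ≟ 0) e))) ρ-zero))
    ... | yes (k , ek , k≢0) with ρ-gcd (toℕ k) (trans (sym (lookup-R k)) ek)
    ...   | d , d∣k , d∣N , ρd with divisors-of-square prime (subst (d ∣_) N≡p*p d∣N)
    ...     | inj₁ refl = r∈⇒all-rotations ρd
    ...     | inj₂ (inj₁ refl) = rᵖ∈⇒rotationPart ρd
    ...     | inj₂ (inj₂ refl) = ⊥-elim (<-irrefl refl (<-≤-trans (toℕ<n k)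
                                   (subst (_≤ toℕ k) (sym N≡p*p) (∣⇒≤ {{≢-nonZero k≢0}} d∣k))))

  module _ (R S : Vec Bool N) (vertex : isVertex (R , S) ≡ true) where
    private
      sg : isSubgroup (R , S) ≡ true
      sg = ∧-elimˡ vertex
      proper : isProper (R , S) ≡ true
      proper = ∧-elimˡ (∧-elimʳ {isSubgroup (R , S)} vertex)
      nontrivial : isNontrivial (R , S) ≡ true
      nontrivial = ∧-elimʳ {isProper (R , S)} (∧-elimʳ {isSubgroup (R , S)} vertex)
    open SubgroupFacts R S sg

    classify-vertex : ∃ λ c → (R , S) ≡ toSub c
    classify-vertex with any? (λ k → lookup S k B.≟ true) | rotationPart R S sg
    ... | no none | identity-only R≗ = ⊥-elim (trivial (any⁻ _ (elems N) nontrivial))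
      where
      trivial : (∃ λ x → x ∈ elems N × (not (isIdentity x) ∧ mem (R , S) x) ≡ true) → ⊥
      trivial ((k , false) , _ , e) = true≢false (∧-intro (⌊⌋-true (toℕ k ≟ 0) k≡0) refl) (not≡true⇒≡false (∧-elimˡ e))
        where
        k≡0 = trans (sym (m<n⇒m%n≡m (toℕ<n k)))
                (⌊⌋-sound (toℕ k % N ≟ 0) (trans (sym (R≗ k)) (∧-elimʳ {not (isIdentity (k , false))} e)))
      trivial ((k , true) , _ , e) = none (k , ∧-elimʳ {not (isIdentity (k , true))} e)
    ... | no none | multiples-of-p R≗ = ⟨rᵖ⟩ , ≡toSub ⟨rᵖ⟩ R≗ (λ k → ≢true⇒≡false λ e → none (k , e))
    ... | no none | all-rotations R≗ = ⟨r⟩ , ≡toSub ⟨r⟩ R≗ (λ k → ≢true⇒≡false λ e → none (k , e))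
    ... | yes (i , ei) | all-rotations R≗ = ⊥-elim (whole (any⁻ _ (elems N) proper))
      where
      whole : (∃ λ x → x ∈ elems N × not (mem (R , S) x) ≡ true) → ⊥
      whole ((k , false) , _ , e) = true≢false (trans (R≗ k) (residue-1 (toℕ k))) (not≡true⇒≡false e)
      whole ((k , true) , _ , e) = true≢false
        (trans (reflections-determined 1 (1∣ N) R≗ i ei k)
          (⌊⌋-true (toℕ k % 1 ≟ toℕ i % 1) (trans (n%1≡0 (toℕ k)) (sym (n%1≡0 (toℕ i))))))
        (not≡true⇒≡false e)
    ... | yes (i , ei) | multiples-of-p R≗ = c , ≡toSub c R≗ λ k →
      trans (reflections-determined p p∣N R≗ i ei k) (cong (λ u → residue p u (toℕ k)) (sym (toℕ-fromℕ< _)))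
      where c = ⟨rᵖ,rʲs⟩ (fromℕ< (m%n<n (toℕ i) p))
    ... | yes (i , ei) | identity-only R≗ =
      let j , t , idx≡i = idx-surjective (toℕ<n i) in
      ⟨rⁱs⟩ j t , ≡toSub (⟨rⁱs⟩ j t) R≗ λ k → trans (reflections-determined N ∣-refl R≗ i ei k)
        (cong (λ u → residue N u (toℕ k)) (trans (m<n⇒m%n≡m (toℕ<n i)) (sym idx≡i)))

  classify : ∀ {H} → H ∈ vertices N → ∃ λ c → H ≡ toSub c
  classify {R , S} H∈V = classify-vertex R S (proj₂ (∈-filter⁻ (λ H → isVertex H B.≟ true) {xs = allSubs N} H∈V))

  vertices-↭ : vertices N ↭ map toSub codes
  vertices-↭ = unique-⇔⇒↭ (Unique.filter⁺ (λ H → isVertex H B.≟ true) (allSubs-unique N))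
                           (Unique.map⁺ toSub-injective codes-unique) to from
    where
    to : ∀ {H} → H ∈ vertices N → H ∈ map toSub codes
    to H∈V with classify H∈V
    ... | c , refl = ∈-map⁺ toSub (codes-complete c)
    from : ∀ {H} → H ∈ map toSub codes → H ∈ vertices N
    from m with ∈-map⁻ toSub {xs = codes} m
    ... | c , _ , refl = toSub∈vertices c

module Distances (q : ℕ) (prime : Prime (suc (suc q))) where
  open PrimeSquare q
  open Classification q prime

  few-distances : ∀ {d} → d ≤ 3 → d < length (vertices N)
  few-distances d≤3 = ≤-trans (s≤s d≤3)
    (subst (4 ≤_) (sym (trans (↭-length vertices-↭) (length-map toSub codes))) (s≤s (s≤s (s≤s (s≤s z≤n)))))

  private
    dist-toSub-0 : ∀ c → dist (toSub c) (toSub c) ≡ just 0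
    dist-toSub-0 c = dist-0 (toSub c) (few-distances z≤n)

    dist-toSub-1 : ∀ c c′ → c ≢ c′ → adjacentC c c′ ≡ true → dist (toSub c) (toSub c′) ≡ just 1
    dist-toSub-1 c c′ c≢c′ a =
      dist-1 (few-distances (s≤s z≤n)) (toSub∈vertices c′) (c≢c′ ∘ toSub-injective) (trans (adj≡ c c′) a)

    dist-toSub-2 : ∀ c m c′ → c ≢ c′ → adjacentC c c′ ≡ false → adjacentC c m ≡ true → adjacentC m c′ ≡ true →
         dist (toSub c) (toSub c′) ≡ just 2
    dist-toSub-2 c m c′ c≢c′ na a a′ = dist-2 (few-distances (s≤s (s≤s z≤n))) (toSub∈vertices m) (toSub∈vertices c′)
      (c≢c′ ∘ toSub-injective) (trans (adj≡ c c′) na) (trans (adj≡ c m) a) (trans (adj≡ m c′) a′)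

    neighbours-of-⟨rⁱs⟩ : ∀ j t m → adjacentC (⟨rⁱs⟩ j t) m ≡ true → m ≡ ⟨rᵖ,rʲs⟩ j
    neighbours-of-⟨rⁱs⟩ j t (⟨rᵖ,rʲs⟩ j′) a = cong ⟨rᵖ,rʲs⟩ (sym (⌊⌋-sound (j F.≟ j′) a))

    -- Reflection subgroups in different rows are joined only through their two dihedral neighbours.
    dist-toSub-3 : ∀ j t j′ t′ → j ≢ j′ → dist (toSub (⟨rⁱs⟩ j t)) (toSub (⟨rⁱs⟩ j′ t′)) ≡ just 3
    dist-toSub-3 j t j′ t′ j≢j′ =
      dist-3 (few-distances ≤-refl) (toSub∈vertices (⟨rᵖ,rʲs⟩ j)) (toSub∈vertices (⟨rᵖ,rʲs⟩ j′)) (toSub∈vertices (⟨rⁱs⟩ j′ t′))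
      (λ e → j≢j′ (row-injective (toSub-injective {⟨rⁱs⟩ j t} {⟨rⁱs⟩ j′ t′} e))) (adj≡ (⟨rⁱs⟩ j t) (⟨rⁱs⟩ j′ t′)) no-common
      (trans (adj≡ (⟨rⁱs⟩ j t) (⟨rᵖ,rʲs⟩ j)) (⌊≟⌋-refl j))
      (trans (adj≡ (⟨rᵖ,rʲs⟩ j) (⟨rᵖ,rʲs⟩ j′)) (cong not (⌊⌋-false (j F.≟ j′) j≢j′)))
      (trans (adj≡ (⟨rᵖ,rʲs⟩ j′) (⟨rⁱs⟩ j′ t′)) (⌊≟⌋-refl j′))
      where
      row-injective : ∀ {j t j′ t′} → ⟨rⁱs⟩ j t ≡ ⟨rⁱs⟩ j′ t′ → j ≡ j′
      row-injective refl = refl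
      no-common : ∀ M → M ∈ vertices N → adj (toSub (⟨rⁱs⟩ j t)) M ≡ true →
                  M ≢ toSub (⟨rⁱs⟩ j′ t′) × adj M (toSub (⟨rⁱs⟩ j′ t′)) ≡ false
      no-common M M∈V a with classify M∈V
      ... | m , refl with neighbours-of-⟨rⁱs⟩ j t m (trans (sym (adj≡ (⟨rⁱs⟩ j t) m)) a)
      ...   | refl = (λ e → case toSub-injective {⟨rᵖ,rʲs⟩ j} {⟨rⁱs⟩ j′ t′} e of λ ()) ,
                     trans (adj≡ (⟨rᵖ,rʲs⟩ j) (⟨rⁱs⟩ j′ t′)) (⌊⌋-false (j F.≟ j′) j≢j′)

  dist≡δ : ∀ c c′ → dist (toSub c) (toSub c′) ≡ just (δ c c′)
  dist≡δ c@⟨rᵖ⟩ ⟨rᵖ⟩ = dist-toSub-0 c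
  dist≡δ c@⟨rᵖ⟩ c′@⟨r⟩ = dist-toSub-1 c c′ (λ ()) refl
  dist≡δ c@⟨rᵖ⟩ c′@(⟨rᵖ,rʲs⟩ _) = dist-toSub-1 c c′ (λ ()) refl
  dist≡δ c@⟨rᵖ⟩ c′@(⟨rⁱs⟩ j _) = dist-toSub-2 c (⟨rᵖ,rʲs⟩ j) c′ (λ ()) refl refl (⌊≟⌋-refl j)
  dist≡δ c@⟨r⟩ c′@⟨rᵖ⟩ = dist-toSub-1 c c′ (λ ()) refl
  dist≡δ c@⟨r⟩ ⟨r⟩ = dist-toSub-0 c
  dist≡δ c@⟨r⟩ c′@(⟨rᵖ,rʲs⟩ _) = dist-toSub-1 c c′ (λ ()) refl
  dist≡δ c@⟨r⟩ c′@(⟨rⁱs⟩ j _) = dist-toSub-2 c (⟨rᵖ,rʲs⟩ j) c′ (λ ()) refl refl (⌊≟⌋-refl j)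
  dist≡δ c@(⟨rᵖ,rʲs⟩ _) c′@⟨rᵖ⟩ = dist-toSub-1 c c′ (λ ()) refl
  dist≡δ c@(⟨rᵖ,rʲs⟩ _) c′@⟨r⟩ = dist-toSub-1 c c′ (λ ()) refl
  dist≡δ c@(⟨rᵖ,rʲs⟩ j) c′@(⟨rᵖ,rʲs⟩ j′) with j F.≟ j′
  ... | yes refl = dist-toSub-0 c
  ... | no j≢j′ = dist-toSub-1 c c′ (λ { refl → j≢j′ refl }) (cong not (⌊⌋-false (j F.≟ j′) j≢j′))
  dist≡δ c@(⟨rᵖ,rʲs⟩ j) c′@(⟨rⁱs⟩ j′ _) with j F.≟ j′
  ... | yes refl = dist-toSub-1 c c′ (λ ()) (⌊≟⌋-refl j)
  ... | no j≢j′ =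
    dist-toSub-2 c (⟨rᵖ,rʲs⟩ j′) c′ (λ ()) (⌊⌋-false (j F.≟ j′) j≢j′) (cong not (⌊⌋-false (j F.≟ j′) j≢j′)) (⌊≟⌋-refl j′)
  dist≡δ c@(⟨rⁱs⟩ j _) c′@⟨rᵖ⟩ = dist-toSub-2 c (⟨rᵖ,rʲs⟩ j) c′ (λ ()) refl (⌊≟⌋-refl j) refl
  dist≡δ c@(⟨rⁱs⟩ j _) c′@⟨r⟩ = dist-toSub-2 c (⟨rᵖ,rʲs⟩ j) c′ (λ ()) refl (⌊≟⌋-refl j) refl
  dist≡δ c@(⟨rⁱs⟩ j _) c′@(⟨rᵖ,rʲs⟩ j′) with j F.≟ j′
  ... | yes refl = dist-toSub-1 c c′ (λ ()) (⌊≟⌋-refl j)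
  ... | no j≢j′ =
    dist-toSub-2 c (⟨rᵖ,rʲs⟩ j) c′ (λ ()) (⌊⌋-false (j F.≟ j′) j≢j′) (⌊≟⌋-refl j) (cong not (⌊⌋-false (j F.≟ j′) j≢j′))
  dist≡δ c@(⟨rⁱs⟩ j t) c′@(⟨rⁱs⟩ j′ t′) with j F.≟ j′
  ... | no j≢j′ = dist-toSub-3 j t j′ t′ j≢j′
  ... | yes refl with t F.≟ t′
  ...   | yes refl = dist-toSub-0 c
  ...   | no t≢t′ = dist-toSub-2 c (⟨rᵖ,rʲs⟩ j) c′ (λ { refl → t≢t′ refl }) refl (⌊≟⌋-refl j) (⌊≟⌋-refl j)

module HyperWienerIndex (q : ℕ) (prime : Prime (suc (suc q))) where
  open PrimeSquare q
  open Classification q prime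
  open Distances q prime

  -- The value 0 for unreachable pairs is never used: on vertices `dist` is always `just`.
  D : Sub N → Sub N → ℕ
  D H K = fromMaybe 0 (dist H K)

  D-toSub : ∀ c c′ → D (toSub c) (toSub c′) ≡ δ c c′
  D-toSub c c′ = cong (fromMaybe 0) (dist≡δ c c′)

  dist-vertices : ∀ {u v} → u ∈ vertices N → v ∈ vertices N → dist u v ≡ just (D u v)
  dist-vertices u∈V v∈V with classify u∈V | classify v∈V
  ... | c , refl | c′ , refl = trans (dist≡δ c c′) (cong just (sym (D-toSub c c′)))

  D-sym : ∀ u v → u ∈ vertices N → v ∈ vertices N → D u v ≡ D v u
  D-sym u v u∈V v∈V with classify u∈V | classify v∈V
  ... | c , refl | c′ , refl = trans (D-toSub c c′) (trans (δ-sym c c′) (sym (D-toSub c′ c)))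

  D-diagonal : ∀ u → u ∈ vertices N → D u u ≡ 0
  D-diagonal u u∈V with classify u∈V
  ... | c , refl = trans (D-toSub c c) (δ-diagonal c)

  twice-pairSum : ∀ (f : ℕ → ℕ) → f 0 ≡ 0 → 2 * pairSum (vertices N) (λ u v → f (D u v)) ≡ ΣΣ codes (λ c c′ → f (δ c c′))
  twice-pairSum f f0 = begin
    2 * pairSum (vertices N) (λ u v → f (D u v))
      ≡⟨ pairSum-double (λ u v → f (D u v)) (vertices N)
           (λ u v u∈ v∈ → cong f (D-sym u v u∈ v∈)) (λ u u∈ → trans (cong f (D-diagonal u u∈)) f0) ⟩
    ΣΣ (vertices N) (λ u v → f (D u v))  ≡⟨ ΣΣ-↭ (λ u v → f (D u v)) vertices-↭ ⟩
    ΣΣ (map toSub codes) (λ u v → f (D u v))  ≡⟨ ΣΣ-map (λ u v → f (D u v)) toSub codes ⟩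
    ΣΣ codes (λ c c′ → f (D (toSub c) (toSub c′)))  ≡⟨ sum-cong codes (λ c → sum-cong codes λ c′ → cong f (D-toSub c c′)) ⟩
    ΣΣ codes (λ c c′ → f (δ c c′))  ∎
    where open ≡-Reasoning

  Σd Σd² : ℕ
  Σd = pairSum (vertices N) D
  Σd² = pairSum (vertices N) (λ u v → D u v * D u v)

  wiener≡ : wiener N ≡ just Σd
  wiener≡ = sumMaybe-just _ (λ (u , v) → D u v) (pairs (vertices N)) λ uv uv∈ →
    let u∈ , v∈ = ∈-pairs⁻ (vertices N) uv∈ in dist-vertices u∈ v∈

  sumSqDist≡ : sumSqDist N ≡ just Σd²
  sumSqDist≡ = sumMaybe-just _ (λ (u , v) → D u v * D u v) (pairs (vertices N)) λ uv uv∈ →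
    let u∈ , v∈ = ∈-pairs⁻ (vertices N) uv∈ in cong (mapMaybe (λ d → d * d)) (dist-vertices u∈ v∈)

  Σd+Σd² : Σd + Σd² ≡ 6 * p ^ 4 + 3 * p ^ 3 + 6 * p ^ 2 + 3 * p + 2
  Σd+Σd² = *-cancelˡ-≡ _ _ 2 (begin
    2 * (Σd + Σd²)  ≡⟨ *-distribˡ-+ 2 Σd Σd² ⟩
    2 * Σd + 2 * Σd²  ≡⟨ cong₂ _+_ (twice-pairSum (λ d → d) refl) (twice-pairSum (λ d → d * d) refl) ⟩
    ΣΣ codes δ + ΣΣ codes (λ c c′ → δ c c′ * δ c c′)  ≡⟨ ΣΣ-+ δ (λ c c′ → δ c c′ * δ c c′) codes ⟨
    ΣΣ codes (λ c c′ → d+d² (δ c c′))  ≡⟨ ΣΣ-d+d² ⟩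
    row-cyclic + (row-cyclic + (p * row-dihedral + p * (p * row-reflection)))  ≡⟨ ΣΣ-d+d²-value ⟩
    2 * (6 * p ^ 4 + 3 * p ^ 3 + 6 * p ^ 2 + 3 * p + 2)  ∎)
    where open ≡-Reasoning

theorem3p2 : (p : ℕ) → Prime p →
    hyperWiener (p ^ 2) ≡ just (½ *ℚ ℕtoℚ (6 * p ^ 4 + 3 * p ^ 3 + 6 * p ^ 2 + 3 * p + 2))
theorem3p2 zero pr = ⊥-elim (¬prime[0] pr)
theorem3p2 (suc zero) pr = ⊥-elim (¬prime[1] pr)
theorem3p2 (suc (suc q)) pr =
  trans (hyperWiener-just (suc (suc q) ^ 2) wiener≡ sumSqDist≡) (cong (λ x → just (½ *ℚ ℕtoℚ x)) Σd+Σd²)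
  where open HyperWienerIndex q pr
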